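{- Let $p$ be an odd prime. For integers $c\geq 1$ and $n\geq 0$, let $a_c(n)$ be defined by $\sum_{n\geq 0} a_c(n)q^n=\prod_{j\geq 1}\frac{1}{(1-q^j)(1-q^{2j})^{c-1}}$. Let $r$ be an integer with $1\leq r\leq p-1$ such that $8r+1$ is a quadratic nonresidue modulo $p$. Then for all $n\geq 0$, $a_{p-1}(pn+r)\equiv 0 \pmod{p}$.
   Context: Combinatorially, $a_c(n)$ is the number of generalized cubic partitions of $n$: partitions of $n$ in which each even part may appear in $c$ different colors, with $a_c(0)=1$. The generating function identity is a formal power series identity in $q$. -}

module Defs where

open import Data.Nat using (ℕ; zero; suc; _+_; _*_; _∸_; _≤ᵇ_; _%_; NonZero)
open import Data.Bool using (if_then_else_)
open import Data.Product using (∃-syntax)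
open import Relation.Nullary using (¬_)
open import Relation.Binary.PropositionalEquality using (_≡_)

Series : Set
Series = ℕ → ℕ

sumTo : ℕ → (ℕ → ℕ) → ℕ
sumTo zero    f = f 0
sumTo (suc n) f = sumTo n f + f (suc n)

one : Series
one zero    = 1
one (suc _) = 0

-- Multiplication of a series s by 1/(1 - q^k) = Σ_{i≥0} q^(i k), for k ≥ 1:
-- coefficient n is Σ_{i ≥ 0, i k ≤ n} s(n - i k).  (Since k ≥ 1, i ≤ n.)
geomMul : ℕ → Series → Series
geomMul k s n = sumTo n (λ i → if (i * k) ≤ᵇ n then s (n ∸ i * k) else 0)

geomPow : ℕ → ℕ → Series → Series
geomPow k zero    s = s
geomPow k (suc m) s = geomMul k (geomPow k m s)

cubicProd : ℕ → ℕ → Series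
cubicProd c zero    = one
cubicProd c (suc N) = geomMul (suc N) (geomPow (2 * suc N) (c ∸ 1) (cubicProd c N))

-- a_c(n): coefficient of q^n in Π_{j≥1} 1/((1-q^j)(1-q^{2j})^{c-1}).
-- Factors with j > n do not affect the coefficient of q^n, so truncating at j = n is exact.
a : ℕ → ℕ → ℕ
a c n = cubicProd c n n

QuadNonresidue : (p : ℕ) → .{{NonZero p}} → ℕ → Set
QuadNonresidue p m = ¬ (∃[ x ] ((x * x) % p ≡ m % p))

-- Modulo p, 1/(1 - q^(2j))^(p-2) ≡ (1 - q^(2j))² / (1 - q^(2pj)) because (1 - x)^p ≡ 1 - x^p, so the generating
-- function of a_(p-1) is congruent to ψ(q) / Π_j (1 - q^(2pj)), where ψ(q) = Π_j (1 + q^j)² (1 - q^j). Dividing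
-- by 1 - q^(2pj) only adds shifts by multiples of p, which keep each residue class of exponents mod p to itself, so
-- it suffices that ψ has no terms in the class of r. By Gauss, ψ(q) = Σ_i q^(i(i+1)/2); only the vanishing of the
-- other coefficients is needed, and it follows from Rothe's q-binomial theorem much as in the proof of Jacobi's
-- triple product. A triangular exponent j = i(i+1)/2 satisfies 8j + 1 = (2i + 1)², so j mod p = r would make
-- 8r + 1 a square mod p.
-- Series are coefficient sequences ℕ → ℤ, and products with 1 ± q^k and 1/(1 - q^k) are linear operators on them.

module Submission where

open import Defs
open import Data.Nat using (ℕ; _+_; _*_; _∸_; _≤_; _<_; NonZero)
open import Data.Nat.Divisibility using (_∣_)
open import Data.Nat.Primality using (Prime)

open import Data.Nat using (zero; suc; z≤n; s≤s; _≤?_; _≤ᵇ_; _%_; _/_)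
open import Data.Nat.DivMod using (m≡m%n+[m/n]*n; m%n<n; [m+kn]%n≡m%n; m<n⇒m%n≡m)
open import Data.Nat.Divisibility using (divides; ∣⇒≤; m%n≡0⇒n∣m)
open import Data.Nat.Primality using (euclidsLemma; prime⇒irreducible)
import Data.Nat.Tactic.RingSolver as ℕ-Solver
import Data.Nat.Properties as ℕₚ
open import Data.Nat.Induction using (<-rec)
open import Data.Nat.Combinatorics using (_C_; nCk+nC[k+1]≡[n+1]C[k+1]; k>n⇒nCk≡0; nC1≡n; nCn≡1)
open import Data.Integer as ℤ using (ℤ; +_; 0ℤ; 1ℤ; -1ℤ)
import Data.Integer.Properties as ℤₚ
open import Data.Integer.Divisibility.Signed using (∣ᵤ⇒∣; ∣⇒∣ᵤ; ∣m∣n⇒∣m+n; ∣m⇒∣-m; ∣n⇒∣m*n; ∣m⇒∣m*n) renaming (_∣_ to _∣ℤ_; divides to dividesℤ)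
open import Data.Integer.Tactic.RingSolver using (solve-∀)
open import Level using (0ℓ)
open import Function using (id; _∘_)
open import Relation.Binary.Bundles using (Setoid)
open import Relation.Binary.Core using (_Preserves_⟶_)
open import Relation.Binary.Structures using (IsEquivalence)
import Relation.Binary.Reasoning.Setoid as SetoidReasoning
open import Relation.Binary.PropositionalEquality
open import Relation.Nullary using (¬_; Dec; yes; no)
open import Data.Bool using (true; false; if_then_else_; T)
open import Data.Unit using (tt)
open import Data.Bool.Properties using (T-≡)
open import Function.Bundles using (Equivalence)
open import Data.Empty using (⊥-elim)
open import Data.Sum using (_⊎_; inj₁; inj₂)
open import Data.Product using (_,_; _×_; ∃-syntax)
open import Relation.Binary.Definitions using (tri<; tri≈; tri>)

-- Formal power series with integer coefficients

ℤSeries : Set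
ℤSeries = ℕ → ℤ

Op : Set
Op = ℤSeries → ℤSeries

infixl 6 _+ₛ_ _-ₛ_
_+ₛ_ _-ₛ_ : ℤSeries → ℤSeries → ℤSeries
(s +ₛ t) n = s n ℤ.+ t n
(s -ₛ t) n = s n ℤ.- t n

0ₛ 1ₛ : ℤSeries
0ₛ _       = 0ℤ
1ₛ zero    = 1ℤ
1ₛ (suc _) = 0ℤ

-- shift k s = q^k · s
shift : ℕ → Op
shift k s n with k ≤? n
... | yes _ = s (n ∸ k)
... | no  _ = 0ℤ

shift-≤ : ∀ k s {n} → k ≤ n → shift k s n ≡ s (n ∸ k)
shift-≤ k s {n} k≤n with k ≤? n
... | yes _   = refl
... | no  k≰n = ⊥-elim (k≰n k≤n)

shift-≰ : ∀ k s {n} → ¬ k ≤ n → shift k s n ≡ 0ℤ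
shift-≰ k s {n} k≰n with k ≤? n
... | yes k≤n = ⊥-elim (k≰n k≤n)
... | no  _   = refl

shift-local : ∀ k {s t} n → (k ≤ n → s (n ∸ k) ≡ t (n ∸ k)) → shift k s n ≡ shift k t n
shift-local k n eq with k ≤? n
... | yes k≤n = eq k≤n
... | no  _   = refl

shift-cong : ∀ k → shift k Preserves _≗_ ⟶ _≗_
shift-cong k s≗t n = shift-local k n (λ _ → s≗t _)

shift-0ₛ : ∀ k → shift k 0ₛ ≗ 0ₛ
shift-0ₛ k n with k ≤? n
... | yes _ = refl
... | no  _ = refl

shift-zipWith : ∀ k (_⊙_ : ℤ → ℤ → ℤ) → 0ℤ ⊙ 0ℤ ≡ 0ℤ → ∀ s t →
                shift k (λ n → s n ⊙ t n) ≗ λ n → shift k s n ⊙ shift k t n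
shift-zipWith k _⊙_ 0⊙0 s t n with k ≤? n
... | yes _ = refl
... | no  _ = sym 0⊙0

shift-+ : ∀ k s t → shift k (s +ₛ t) ≗ shift k s +ₛ shift k t
shift-+ k = shift-zipWith k ℤ._+_ refl


shift-scale : ∀ k c s → shift k (λ n → c ℤ.* s n) ≗ λ n → c ℤ.* shift k s n
shift-scale k c s = shift-zipWith k (λ _ x → c ℤ.* x) (ℤₚ.*-zeroʳ c) s s

shift-0 : ∀ s → shift 0 s ≗ s
shift-0 s n = shift-≤ 0 s z≤n

shift-shift : ∀ a b s → shift a (shift b s) ≗ shift (a + b) s
shift-shift a b s n with a ≤? n
... | no a≰n = sym (shift-≰ (a + b) s (λ a+b≤n → a≰n (ℕₚ.≤-trans (ℕₚ.m≤m+n a b) a+b≤n)))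
... | yes a≤n with b ≤? n ∸ a
...   | yes b≤n∸a = begin
        s (n ∸ a ∸ b)     ≡⟨ cong s (ℕₚ.∸-+-assoc n a b) ⟩
        s (n ∸ (a + b))   ≡⟨ shift-≤ (a + b) s a+b≤n ⟨
        shift (a + b) s n ∎
  where
  open ≡-Reasoning
  a+b≤n : a + b ≤ n
  a+b≤n = subst (a + b ≤_) (ℕₚ.m+[n∸m]≡n a≤n) (ℕₚ.+-monoʳ-≤ a b≤n∸a)
...   | no b≰n∸a = sym (shift-≰ (a + b) s λ a+b≤n →
                    b≰n∸a (subst (_≤ n ∸ a) (ℕₚ.m+n∸m≡n a b) (ℕₚ.∸-monoˡ-≤ a a+b≤n)))

shift²-index : ∀ a b {c} s → a + b ≡ c → shift a (shift b s) ≗ shift c s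
shift²-index a b s refl = shift-shift a b s

shift-comm : ∀ a b s → shift a (shift b s) ≗ shift b (shift a s)
shift-comm a b s n = begin
  shift a (shift b s) n ≡⟨ shift-shift a b s n ⟩
  shift (a + b) s n     ≡⟨ cong (λ k → shift k s n) (ℕₚ.+-comm a b) ⟩
  shift (b + a) s n     ≡⟨ shift-shift b a s n ⟨
  shift b (shift a s) n ∎
  where open ≡-Reasoning

shift-+-index : ∀ e k s m → shift (e + k) s (m + e) ≡ shift k s m
shift-+-index e k s m with k ≤? m
... | yes k≤m = trans (shift-≤ (e + k) s e+k≤m+e) (cong s (begin
      m + e ∸ (e + k) ≡⟨ cong (_∸ (e + k)) (ℕₚ.+-comm m e) ⟩
      e + m ∸ (e + k) ≡⟨ ℕₚ.[m+n]∸[m+o]≡n∸o e m k ⟩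
      m ∸ k           ∎))
  where
  open ≡-Reasoning
  e+k≤m+e : e + k ≤ m + e
  e+k≤m+e = subst (e + k ≤_) (ℕₚ.+-comm e m) (ℕₚ.+-monoʳ-≤ e k≤m)
... | no k≰m = shift-≰ (e + k) s λ e+k≤m+e →
               k≰m (ℕₚ.+-cancelˡ-≤ e k m (subst (e + k ≤_) (ℕₚ.+-comm m e) e+k≤m+e))

sumToℤ : ℕ → (ℕ → ℤ) → ℤ
sumToℤ zero    f = f 0
sumToℤ (suc n) f = sumToℤ n f ℤ.+ f (suc n)

sumToℤ-cong : ∀ n {f g} → (∀ i → i ≤ n → f i ≡ g i) → sumToℤ n f ≡ sumToℤ n g
sumToℤ-cong zero    f≡g = f≡g 0 z≤n
sumToℤ-cong (suc n) f≡g =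
  cong₂ ℤ._+_ (sumToℤ-cong n (λ i i≤n → f≡g i (ℕₚ.m≤n⇒m≤1+n i≤n))) (f≡g (suc n) ℕₚ.≤-refl)

sumToℤ-unfoldˡ : ∀ n f → sumToℤ (suc n) f ≡ f 0 ℤ.+ sumToℤ n (f ∘ suc)
sumToℤ-unfoldˡ zero    f = refl
sumToℤ-unfoldˡ (suc n) f =
  trans (cong (ℤ._+ f (suc (suc n))) (sumToℤ-unfoldˡ n f)) (ℤₚ.+-assoc (f 0) _ _)

sumToℤ-zipWith : ∀ n (_⊙_ : ℤ → ℤ → ℤ) → (∀ a b c d → (a ⊙ c) ℤ.+ (b ⊙ d) ≡ (a ℤ.+ b) ⊙ (c ℤ.+ d)) →
                 ∀ f g → sumToℤ n (λ i → f i ⊙ g i) ≡ sumToℤ n f ⊙ sumToℤ n g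
sumToℤ-zipWith zero    _⊙_ interchange f g = refl
sumToℤ-zipWith (suc n) _⊙_ interchange f g =
  trans (cong (ℤ._+ (f (suc n) ⊙ g (suc n))) (sumToℤ-zipWith n _⊙_ interchange f g))
        (interchange _ _ _ _)

sumToℤ-+ : ∀ n f g → sumToℤ n (λ i → f i ℤ.+ g i) ≡ sumToℤ n f ℤ.+ sumToℤ n g
sumToℤ-+ n = sumToℤ-zipWith n ℤ._+_ solve-∀

sumToℤ-- : ∀ n f g → sumToℤ n (λ i → f i ℤ.- g i) ≡ sumToℤ n f ℤ.- sumToℤ n g
sumToℤ-- n = sumToℤ-zipWith n ℤ._-_ solve-∀

sumToℤ-zero : ∀ n {f} → (∀ i → i ≤ n → f i ≡ 0ℤ) → sumToℤ n f ≡ 0ℤ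
sumToℤ-zero zero    f≡0 = f≡0 0 z≤n
sumToℤ-zero (suc n) f≡0 =
  cong₂ ℤ._+_ (sumToℤ-zero n (λ i i≤n → f≡0 i (ℕₚ.m≤n⇒m≤1+n i≤n))) (f≡0 (suc n) ℕₚ.≤-refl)

sumToℤ-vanishing-tail : ∀ {m} n f → m ≤ n → (∀ i → m < i → f i ≡ 0ℤ) → sumToℤ n f ≡ sumToℤ m f
sumToℤ-vanishing-tail zero    f z≤n tail = refl
sumToℤ-vanishing-tail {m} (suc n) f m≤1+n tail with ℕₚ.m≤n⇒m<n∨m≡n m≤1+n
... | inj₂ refl = refl
... | inj₁ (s≤s m≤n) = begin
  sumToℤ n f ℤ.+ f (suc n) ≡⟨ cong (ℤ._+_ (sumToℤ n f)) (tail (suc n) (s≤s m≤n)) ⟩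
  sumToℤ n f ℤ.+ 0ℤ        ≡⟨ ℤₚ.+-identityʳ _ ⟩
  sumToℤ n f               ≡⟨ sumToℤ-vanishing-tail n f m≤n tail ⟩
  sumToℤ m f               ∎
  where open ≡-Reasoning

sumToℤ-pascal : ∀ M {x y z : ℕ → ℤ} → x 0 ≡ y 0 → (∀ k → x (suc k) ≡ y (suc k) ℤ.+ z k) → y (suc M) ≡ 0ℤ →
                sumToℤ (suc M) x ≡ sumToℤ M y ℤ.+ sumToℤ M z
sumToℤ-pascal M {x} {y} {z} x0≡y0 x≡y+z y[1+M]≡0 = begin
  sumToℤ (suc M) x                              ≡⟨ sumToℤ-unfoldˡ M x ⟩
  x 0 ℤ.+ sumToℤ M (x ∘ suc)                    ≡⟨ cong₂ ℤ._+_ x0≡y0 (trans (sumToℤ-cong M λ k _ → x≡y+z k) (sumToℤ-+ M (y ∘ suc) z)) ⟩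
  y 0 ℤ.+ (sumToℤ M (y ∘ suc) ℤ.+ sumToℤ M z)   ≡⟨ ℤₚ.+-assoc (y 0) _ _ ⟨
  y 0 ℤ.+ sumToℤ M (y ∘ suc) ℤ.+ sumToℤ M z     ≡⟨ cong (ℤ._+ sumToℤ M z) (sumToℤ-unfoldˡ M y) ⟨
  sumToℤ M y ℤ.+ y (suc M) ℤ.+ sumToℤ M z       ≡⟨ cong (λ t → sumToℤ M y ℤ.+ t ℤ.+ sumToℤ M z) y[1+M]≡0 ⟩
  sumToℤ M y ℤ.+ 0ℤ ℤ.+ sumToℤ M z              ≡⟨ cong (ℤ._+ sumToℤ M z) (ℤₚ.+-identityʳ (sumToℤ M y)) ⟩
  sumToℤ M y ℤ.+ sumToℤ M z                     ∎
  where open ≡-Reasoning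

sumToℤ-ℕ : ∀ n f → + sumTo n f ≡ sumToℤ n (+_ ∘ f)
sumToℤ-ℕ zero    f = refl
sumToℤ-ℕ (suc n) f = trans (ℤₚ.pos-+ (sumTo n f) (f (suc n))) (cong (ℤ._+ + f (suc n)) (sumToℤ-ℕ n f))

sumSeries : ℕ → (ℕ → ℤSeries) → ℤSeries
sumSeries n f m = sumToℤ n (λ i → f i m)

shift-sumSeries : ∀ k n f → shift k (sumSeries n f) ≗ sumSeries n (shift k ∘ f)
shift-sumSeries k zero    f m = refl
shift-sumSeries k (suc n) f m =
  trans (shift-+ k (sumSeries n f) (f (suc n)) m) (cong (ℤ._+ shift k (f (suc n)) m) (shift-sumSeries k n f m))

mulOnePlus mulOneMinus : ℕ → Op
mulOnePlus  k s = s +ₛ shift k s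
mulOneMinus k s = s -ₛ shift k s

-- Meant for k ≥ 1: then q^(i k) contributes to degree n only for i ≤ n.
divOneMinus : ℕ → Op
divOneMinus k s n = sumToℤ n (λ i → shift (i * k) s n)

divOneMinus-sumTo : ∀ k' s {m} n → m ≤ n → sumToℤ n (λ i → shift (i * suc k') s m) ≡ divOneMinus (suc k') s m
divOneMinus-sumTo k' s {m} n m≤n = sumToℤ-vanishing-tail n _ m≤n λ i m<i →
  shift-≰ (i * suc k') s λ ik≤m → ℕₚ.<⇒≱ m<i (ℕₚ.≤-trans (ℕₚ.m≤m*n i (suc k')) ik≤m)

divOneMinus-rec : ∀ k' s n → divOneMinus (suc k') s n ≡ s n ℤ.+ shift (suc k') (divOneMinus (suc k') s) n
divOneMinus-rec k' s zero = begin
  shift 0 s 0                              ≡⟨ shift-0 s 0 ⟩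
  s 0                                      ≡⟨ ℤₚ.+-identityʳ (s 0) ⟨
  s 0 ℤ.+ 0ℤ                               ≡⟨ cong (ℤ._+_ (s 0)) (shift-≰ (suc k') (divOneMinus (suc k') s) {0} λ ()) ⟨
  s 0 ℤ.+ shift (suc k') (divOneMinus (suc k') s) 0 ∎
  where open ≡-Reasoning
divOneMinus-rec k' s (suc n) = begin
  sumToℤ (suc n) (λ i → shift (i * k) s (suc n))
    ≡⟨ sumToℤ-unfoldˡ n _ ⟩
  shift 0 s (suc n) ℤ.+ sumToℤ n (λ i → shift (k + i * k) s (suc n))
    ≡⟨ cong₂ ℤ._+_ (shift-0 s (suc n)) (sumToℤ-cong n λ i _ → sym (shift-shift k (i * k) s (suc n))) ⟩
  s (suc n) ℤ.+ sumToℤ n (λ i → shift k (shift (i * k) s) (suc n))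
    ≡⟨ cong (ℤ._+_ (s (suc n))) (shift-sumSeries k n (λ i → shift (i * k) s) (suc n)) ⟨
  s (suc n) ℤ.+ shift k (λ m → sumToℤ n (λ i → shift (i * k) s m)) (suc n)
    ≡⟨ cong (ℤ._+_ (s (suc n))) (shift-local k (suc n) λ _ →
         divOneMinus-sumTo k' s n (ℕₚ.m∸n≤m n k')) ⟩
  s (suc n) ℤ.+ shift k (divOneMinus k s) (suc n)
    ∎
  where
  open ≡-Reasoning
  k = suc k'

divOneMinus-unique : ∀ k' s u → (∀ n → u n ≡ s n ℤ.+ shift (suc k') u n) → u ≗ divOneMinus (suc k') s
divOneMinus-unique k' s u u-rec = <-rec _ step
  where
  step : ∀ n → (∀ {m} → m < n → u m ≡ divOneMinus (suc k') s m) → u n ≡ divOneMinus (suc k') s n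
  step n ih = begin
    u n                                              ≡⟨ u-rec n ⟩
    s n ℤ.+ shift (suc k') u n                       ≡⟨ cong (ℤ._+_ (s n)) (shift-local (suc k') n λ k≤n →
                                                          ih (ℕₚ.∸-monoʳ-< {n} {suc k'} {0} (s≤s z≤n) k≤n)) ⟩
    s n ℤ.+ shift (suc k') (divOneMinus (suc k') s) n ≡⟨ divOneMinus-rec k' s n ⟨
    divOneMinus (suc k') s n                         ∎
    where open ≡-Reasoning

-- Linear shift-invariant operators

record IsLinearShiftInvariant (F : Op) : Set where
  field
    preserves-≗ : F Preserves _≗_ ⟶ _≗_
    +ₛ-homo     : ∀ s t → F (s +ₛ t) ≗ F s +ₛ F t
    shift-homo  : ∀ k s → F (shift k s) ≗ shift k (F s)

  -ₛ-homo : ∀ s t → F (s -ₛ t) ≗ F s -ₛ F t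
  -ₛ-homo s t n = begin
    F (s -ₛ t) n                     ≡⟨ sym (x+y-y≡x (F (s -ₛ t) n) (F t n)) ⟩
    F (s -ₛ t) n ℤ.+ F t n ℤ.- F t n ≡⟨ cong (ℤ._- F t n) (+ₛ-homo (s -ₛ t) t n) ⟨
    F ((s -ₛ t) +ₛ t) n ℤ.- F t n    ≡⟨ cong (ℤ._- F t n) (preserves-≗ (λ m → x-y+y≡x (s m) (t m)) n) ⟩
    F s n ℤ.- F t n                  ∎
    where
    open ≡-Reasoning
    x+y-y≡x : ∀ x y → x ℤ.+ y ℤ.- y ≡ x
    x+y-y≡x = solve-∀
    x-y+y≡x : ∀ x y → x ℤ.- y ℤ.+ y ≡ x
    x-y+y≡x = solve-∀

  sumSeries-homo : ∀ n f → F (sumSeries n f) ≗ sumSeries n (F ∘ f)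
  sumSeries-homo zero    f m = refl
  sumSeries-homo (suc n) f m =
    trans (+ₛ-homo (sumSeries n f) (f (suc n)) m) (cong (ℤ._+ F (f (suc n)) m) (sumSeries-homo n f m))

  mulOnePlus-comm : ∀ k s → F (mulOnePlus k s) ≗ mulOnePlus k (F s)
  mulOnePlus-comm k s n = trans (+ₛ-homo s (shift k s) n) (cong (ℤ._+_ (F s n)) (shift-homo k s n))

  mulOneMinus-comm : ∀ k s → F (mulOneMinus k s) ≗ mulOneMinus k (F s)
  mulOneMinus-comm k s n = trans (-ₛ-homo s (shift k s) n) (cong (ℤ._-_ (F s n)) (shift-homo k s n))

  divOneMinus-comm : ∀ k' s → F (divOneMinus (suc k') s) ≗ divOneMinus (suc k') (F s)
  divOneMinus-comm k' s = divOneMinus-unique k' (F s) (F (G s)) λ n → begin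
    F (G s) n                             ≡⟨ preserves-≗ (divOneMinus-rec k' s) n ⟩
    F (s +ₛ shift k (G s)) n              ≡⟨ +ₛ-homo s _ n ⟩
    F s n ℤ.+ F (shift k (G s)) n         ≡⟨ cong (ℤ._+_ (F s n)) (shift-homo k (G s) n) ⟩
    F s n ℤ.+ shift k (F (G s)) n         ∎
    where
    open ≡-Reasoning
    k = suc k'
    G = divOneMinus k

open IsLinearShiftInvariant public

id-linearShiftInvariant : IsLinearShiftInvariant id
id-linearShiftInvariant = record
  { preserves-≗ = id
  ; +ₛ-homo     = λ s t n → refl
  ; shift-homo  = λ k s n → refl
  }

∘-linearShiftInvariant : ∀ {F G} → IsLinearShiftInvariant F → IsLinearShiftInvariant G →
                         IsLinearShiftInvariant (F ∘ G)
∘-linearShiftInvariant {F} {G} LF LG = record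
  { preserves-≗ = preserves-≗ LF ∘ preserves-≗ LG
  ; +ₛ-homo     = λ s t n → trans (preserves-≗ LF (+ₛ-homo LG s t) n) (+ₛ-homo LF (G s) (G t) n)
  ; shift-homo  = λ k s n → trans (preserves-≗ LF (shift-homo LG k s) n) (shift-homo LF k (G s) n)
  }

shift-linearShiftInvariant : ∀ k → IsLinearShiftInvariant (shift k)
shift-linearShiftInvariant k = record
  { preserves-≗ = shift-cong k
  ; +ₛ-homo     = shift-+ k
  ; shift-homo  = λ j s → shift-comm k j s
  }

mulOnePlus-linearShiftInvariant : ∀ k → IsLinearShiftInvariant (mulOnePlus k)
mulOnePlus-linearShiftInvariant k = record
  { preserves-≗ = λ s≗t n → cong₂ ℤ._+_ (s≗t n) (shift-cong k s≗t n)
  ; +ₛ-homo     = λ s t n → trans (cong (ℤ._+_ (s n ℤ.+ t n)) (shift-+ k s t n)) (interchange (s n) (t n) _ _)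
  ; shift-homo  = λ j s n → sym (mulOnePlus-comm (shift-linearShiftInvariant j) k s n)
  }
  where
  interchange : ∀ a b c d → a ℤ.+ b ℤ.+ (c ℤ.+ d) ≡ a ℤ.+ c ℤ.+ (b ℤ.+ d)
  interchange = solve-∀

mulOneMinus-linearShiftInvariant : ∀ k → IsLinearShiftInvariant (mulOneMinus k)
mulOneMinus-linearShiftInvariant k = record
  { preserves-≗ = λ s≗t n → cong₂ ℤ._-_ (s≗t n) (shift-cong k s≗t n)
  ; +ₛ-homo     = λ s t n → trans (cong (ℤ._-_ (s n ℤ.+ t n)) (shift-+ k s t n)) (interchange (s n) (t n) _ _)
  ; shift-homo  = λ j s n → sym (mulOneMinus-comm (shift-linearShiftInvariant j) k s n)
  }
  where
  interchange : ∀ a b c d → a ℤ.+ b ℤ.- (c ℤ.+ d) ≡ a ℤ.- c ℤ.+ (b ℤ.- d)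
  interchange = solve-∀

divOneMinus-linearShiftInvariant : ∀ k' → IsLinearShiftInvariant (divOneMinus (suc k'))
divOneMinus-linearShiftInvariant k' = record
  { preserves-≗ = λ {s} {t} s≗t → sym ∘ divOneMinus-unique k' s (G t) λ n →
      trans (divOneMinus-rec k' t n) (cong (ℤ._+ shift k (G t) n) (sym (s≗t n)))
  ; +ₛ-homo     = λ s t → sym ∘ divOneMinus-unique k' (s +ₛ t) (G s +ₛ G t) λ n → begin
      G s n ℤ.+ G t n
        ≡⟨ cong₂ ℤ._+_ (divOneMinus-rec k' s n) (divOneMinus-rec k' t n) ⟩
      s n ℤ.+ shift k (G s) n ℤ.+ (t n ℤ.+ shift k (G t) n)
        ≡⟨ interchange (s n) _ (t n) _ ⟩
      s n ℤ.+ t n ℤ.+ (shift k (G s) n ℤ.+ shift k (G t) n)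
        ≡⟨ cong (ℤ._+_ (s n ℤ.+ t n)) (shift-+ k (G s) (G t) n) ⟨
      s n ℤ.+ t n ℤ.+ shift k (G s +ₛ G t) n
        ∎
  ; shift-homo  = λ j s n → sym (divOneMinus-comm (shift-linearShiftInvariant j) k' s n)
  }
  where
  open ≡-Reasoning
  k = suc k'
  G = divOneMinus k
  interchange : ∀ a b c d → a ℤ.+ b ℤ.+ (c ℤ.+ d) ≡ a ℤ.+ c ℤ.+ (b ℤ.+ d)
  interchange = solve-∀

mulOneMinus-divOneMinus : ∀ k' s → mulOneMinus (suc k') (divOneMinus (suc k') s) ≗ s
mulOneMinus-divOneMinus k' s n =
  trans (cong (ℤ._- shift (suc k') (divOneMinus (suc k') s) n) (divOneMinus-rec k' s n)) (x+y-y≡x (s n) _)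
  where
  x+y-y≡x : ∀ x y → x ℤ.+ y ℤ.- y ≡ x
  x+y-y≡x = solve-∀

divOneMinus-mulOneMinus : ∀ k' s → divOneMinus (suc k') (mulOneMinus (suc k') s) ≗ s
divOneMinus-mulOneMinus k' s = sym ∘ divOneMinus-unique k' (mulOneMinus (suc k') s) s λ n → x≡x-y+y (s n) _
  where
  x≡x-y+y : ∀ x y → x ≡ x ℤ.- y ℤ.+ y
  x≡x-y+y = solve-∀

infix 4 _≡[≤_]_
_≡[≤_]_ : ℤSeries → ℕ → ℤSeries → Set
s ≡[≤ L ] t = ∀ j → j ≤ L → s j ≡ t j

≡[≤]-trans : ∀ {s t u L} → s ≡[≤ L ] t → t ≡[≤ L ] u → s ≡[≤ L ] u
≡[≤]-trans s≡t t≡u j j≤L = trans (s≡t j j≤L) (t≡u j j≤L)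

Causal : Op → Set
Causal F = ∀ L → F Preserves _≡[≤ L ]_ ⟶ _≡[≤ L ]_

IdentityBelow : ℕ → Op → Set
IdentityBelow k F = ∀ s n → n < k → F s n ≡ s n

shift-causal : ∀ k → Causal (shift k)
shift-causal k L s≡t j j≤L = shift-local k j λ _ → s≡t (j ∸ k) (ℕₚ.≤-trans (ℕₚ.m∸n≤m j k) j≤L)

mulOnePlus-causal : ∀ k → Causal (mulOnePlus k)
mulOnePlus-causal k L s≡t j j≤L = cong₂ ℤ._+_ (s≡t j j≤L) (shift-causal k L s≡t j j≤L)

mulOneMinus-causal : ∀ k → Causal (mulOneMinus k)
mulOneMinus-causal k L s≡t j j≤L = cong₂ ℤ._-_ (s≡t j j≤L) (shift-causal k L s≡t j j≤L)


mulOnePlus-identityBelow : ∀ k → IdentityBelow k (mulOnePlus k)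
mulOnePlus-identityBelow k s n n<k =
  trans (cong (ℤ._+_ (s n)) (shift-≰ k s (ℕₚ.<⇒≱ n<k))) (ℤₚ.+-identityʳ (s n))

mulOneMinus-identityBelow : ∀ k → IdentityBelow k (mulOneMinus k)
mulOneMinus-identityBelow k s n n<k =
  trans (cong (ℤ._-_ (s n)) (shift-≰ k s (ℕₚ.<⇒≱ n<k))) (ℤₚ.+-identityʳ (s n))

divOneMinus-identityBelow : ∀ k' → IdentityBelow (suc k') (divOneMinus (suc k'))
divOneMinus-identityBelow k' s n n<k = begin
  divOneMinus (suc k') s n                             ≡⟨ divOneMinus-rec k' s n ⟩
  s n ℤ.+ shift (suc k') (divOneMinus (suc k') s) n    ≡⟨ cong (ℤ._+_ (s n)) (shift-≰ (suc k') _ (ℕₚ.<⇒≱ n<k)) ⟩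
  s n ℤ.+ 0ℤ                                           ≡⟨ ℤₚ.+-identityʳ (s n) ⟩
  s n                                                  ∎
  where open ≡-Reasoning

∏ : (ℕ → Op) → ℕ → Op
∏ F zero    = id
∏ F (suc a) = F (suc a) ∘ ∏ F a

module _ (F : ℕ → Op) where

  ∏-linearShiftInvariant : (∀ j → IsLinearShiftInvariant (F (suc j))) → ∀ a → IsLinearShiftInvariant (∏ F a)
  ∏-linearShiftInvariant LF zero    = id-linearShiftInvariant
  ∏-linearShiftInvariant LF (suc a) = ∘-linearShiftInvariant (LF a) (∏-linearShiftInvariant LF a)

  ∏-causal : (∀ j → Causal (F (suc j))) → ∀ a → Causal (∏ F a)
  ∏-causal cF zero    L s≡t = s≡t
  ∏-causal cF (suc a) L s≡t = cF a L (∏-causal cF a L s≡t)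

  ∏-stable : (∀ j → IdentityBelow (suc j) (F (suc j))) → ∀ {a b} → a ≤ b → ∀ s → ∏ F b s ≡[≤ a ] ∏ F a s
  ∏-stable idF {a} {b} a≤b s j j≤a with ℕₚ.m≤n⇒m<n∨m≡n a≤b
  ... | inj₂ refl = refl
  ... | inj₁ (s≤s {n = b'} a≤b') =
    trans (idF b' _ j (s≤s (ℕₚ.≤-trans j≤a a≤b'))) (∏-stable idF a≤b' s j j≤a)

-- The binomial expansion of (1 - q^k)^m

open import Function.Endo.Propositional ℤSeries using (_^_; ^-homo)

signedBinomial : ℕ → ℕ → ℤ
signedBinomial m i = (-1ℤ ℤ.^ i) ℤ.* + (m C i)

signedBinomial-pascal : ∀ m i → signedBinomial (suc m) (suc i) ≡ signedBinomial m (suc i) ℤ.- signedBinomial m i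
signedBinomial-pascal m i = begin
  -1ℤ ℤ.* σ ℤ.* + (suc m C suc i)                   ≡⟨ cong (λ c → -1ℤ ℤ.* σ ℤ.* + c) (nCk+nC[k+1]≡[n+1]C[k+1] m i) ⟨
  -1ℤ ℤ.* σ ℤ.* + (m C i + m C suc i)               ≡⟨ cong (-1ℤ ℤ.* σ ℤ.*_) (ℤₚ.pos-+ (m C i) (m C suc i)) ⟩
  -1ℤ ℤ.* σ ℤ.* (+ (m C i) ℤ.+ + (m C suc i))       ≡⟨ distrib σ (+ (m C i)) (+ (m C suc i)) ⟩
  -1ℤ ℤ.* σ ℤ.* + (m C suc i) ℤ.- σ ℤ.* + (m C i)   ∎
  where
  open ≡-Reasoning
  σ = -1ℤ ℤ.^ i
  distrib : ∀ s a b → -1ℤ ℤ.* s ℤ.* (a ℤ.+ b) ≡ -1ℤ ℤ.* s ℤ.* b ℤ.- s ℤ.* a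
  distrib = solve-∀

signedBinomial-sum-step : ∀ m (w : ℕ → ℤ) →
  sumToℤ (suc m) (λ i → signedBinomial (suc m) i ℤ.* w i)
    ≡ sumToℤ m (λ i → signedBinomial m i ℤ.* w i) ℤ.- sumToℤ m (λ i → signedBinomial m i ℤ.* w (suc i))
signedBinomial-sum-step m w = begin
  sumToℤ (suc m) (λ i → b (suc m) i ℤ.* w i)
    ≡⟨ sumToℤ-unfoldˡ m _ ⟩
  b (suc m) 0 ℤ.* w 0 ℤ.+ sumToℤ m (λ i → b (suc m) (suc i) ℤ.* w (suc i))
    ≡⟨ cong (ℤ._+_ (b m 0 ℤ.* w 0)) (trans (sumToℤ-cong m λ i _ → pascal i) (sumToℤ-- m _ _)) ⟩
  b m 0 ℤ.* w 0 ℤ.+ (sumToℤ m (λ i → b m (suc i) ℤ.* w (suc i)) ℤ.- Σw′)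
    ≡⟨ ℤₚ.+-assoc (b m 0 ℤ.* w 0) _ (ℤ.- Σw′) ⟨
  b m 0 ℤ.* w 0 ℤ.+ sumToℤ m (λ i → b m (suc i) ℤ.* w (suc i)) ℤ.- Σw′
    ≡⟨ cong (ℤ._- Σw′) (sumToℤ-unfoldˡ m _) ⟨
  sumToℤ (suc m) (λ i → b m i ℤ.* w i) ℤ.- Σw′
    ≡⟨ cong (λ x → sumToℤ m (λ i → b m i ℤ.* w i) ℤ.+ x ℤ.- Σw′) last-vanishes ⟩
  sumToℤ m (λ i → b m i ℤ.* w i) ℤ.+ 0ℤ ℤ.- Σw′
    ≡⟨ cong (ℤ._- Σw′) (ℤₚ.+-identityʳ (sumToℤ m (λ i → b m i ℤ.* w i))) ⟩
  sumToℤ m (λ i → b m i ℤ.* w i) ℤ.- Σw′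
    ∎
  where
  open ≡-Reasoning
  b = signedBinomial
  Σw′ = sumToℤ m (λ i → b m i ℤ.* w (suc i))
  pascal : ∀ i → b (suc m) (suc i) ℤ.* w (suc i) ≡ b m (suc i) ℤ.* w (suc i) ℤ.- b m i ℤ.* w (suc i)
  pascal i = trans (cong (ℤ._* w (suc i)) (signedBinomial-pascal m i)) (distrib (b m (suc i)) (b m i) (w (suc i)))
    where
    distrib : ∀ x y z → (x ℤ.- y) ℤ.* z ≡ x ℤ.* z ℤ.- y ℤ.* z
    distrib = solve-∀
  last-vanishes : b m (suc m) ℤ.* w (suc m) ≡ 0ℤ
  last-vanishes = begin
    (-1ℤ ℤ.^ suc m) ℤ.* + (m C suc m) ℤ.* w (suc m) ≡⟨ cong (λ c → (-1ℤ ℤ.^ suc m) ℤ.* + c ℤ.* w (suc m)) (k>n⇒nCk≡0 (ℕₚ.n<1+n m)) ⟩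
    (-1ℤ ℤ.^ suc m) ℤ.* 0ℤ ℤ.* w (suc m)            ≡⟨ cong (ℤ._* w (suc m)) (ℤₚ.*-zeroʳ (-1ℤ ℤ.^ suc m)) ⟩
    0ℤ ℤ.* w (suc m)                                ≡⟨ ℤₚ.*-zeroˡ (w (suc m)) ⟩
    0ℤ                                              ∎

mulOneMinus^-expansion : ∀ k m s → (mulOneMinus k ^ m) s ≗ λ n → sumToℤ m (λ i → signedBinomial m i ℤ.* shift (i * k) s n)
mulOneMinus^-expansion k zero    s n = sym (trans (ℤₚ.*-identityˡ _) (shift-0 s n))
mulOneMinus^-expansion k (suc m) s n = begin
  X n ℤ.- shift k X n
    ≡⟨ cong₂ ℤ._-_ (mulOneMinus^-expansion k m s n) (shift-cong k (mulOneMinus^-expansion k m s) n) ⟩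
  sumToℤ m (λ i → b m i ℤ.* shift (i * k) s n) ℤ.- shift k (λ n′ → sumToℤ m (λ i → b m i ℤ.* shift (i * k) s n′)) n
    ≡⟨ cong (ℤ._-_ (sumToℤ m (λ i → b m i ℤ.* shift (i * k) s n))) (trans
         (shift-sumSeries k m (λ i n′ → b m i ℤ.* shift (i * k) s n′) n)
         (sumToℤ-cong m λ i _ → trans (shift-scale k (b m i) (shift (i * k) s) n)
                                      (cong (b m i ℤ.*_) (shift-shift k (i * k) s n)))) ⟩
  sumToℤ m (λ i → b m i ℤ.* shift (i * k) s n) ℤ.- sumToℤ m (λ i → b m i ℤ.* shift (suc i * k) s n)
    ≡⟨ signedBinomial-sum-step m (λ i → shift (i * k) s n) ⟨
  sumToℤ (suc m) (λ i → b (suc m) i ℤ.* shift (i * k) s n)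
    ∎
  where
  open ≡-Reasoning
  b = signedBinomial
  X = (mulOneMinus k ^ m) s

^-linearShiftInvariant : ∀ {F} → IsLinearShiftInvariant F → ∀ m → IsLinearShiftInvariant (F ^ m)
^-linearShiftInvariant LF zero    = id-linearShiftInvariant
^-linearShiftInvariant LF (suc m) = ∘-linearShiftInvariant LF (^-linearShiftInvariant LF m)

divOneMinus^-mulOneMinus^ : ∀ k' m s → (divOneMinus (suc k') ^ m) ((mulOneMinus (suc k') ^ m) s) ≗ s
divOneMinus^-mulOneMinus^ k' zero    s = λ n → refl
divOneMinus^-mulOneMinus^ k' (suc m) s n = begin
  D ((D ^ m) (M ((M ^ m) s))) n   ≡⟨ preserves-≗ LD (mulOneMinus-comm (^-linearShiftInvariant LD m) k ((M ^ m) s)) n ⟩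
  D (M ((D ^ m) ((M ^ m) s))) n   ≡⟨ divOneMinus-mulOneMinus k' ((D ^ m) ((M ^ m) s)) n ⟩
  (D ^ m) ((M ^ m) s) n           ≡⟨ divOneMinus^-mulOneMinus^ k' m s n ⟩
  s n                             ∎
  where
  open ≡-Reasoning
  k = suc k'
  D = divOneMinus k
  M = mulOneMinus k
  LD = divOneMinus-linearShiftInvariant k'

module Congruence (p : ℕ) where

  Multiple : ℤSeries → Set
  Multiple s = ∀ n → + p ∣ℤ s n

  infix 4 _≡ₚ_
  _≡ₚ_ : ℤSeries → ℤSeries → Set
  s ≡ₚ t = Multiple (s -ₛ t)

  ∣0 : + p ∣ℤ 0ℤ
  ∣0 = dividesℤ 0ℤ refl

  ≗⇒≡ₚ : ∀ {s t} → s ≗ t → s ≡ₚ t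
  ≗⇒≡ₚ {s} s≗t n = subst (λ x → + p ∣ℤ s n ℤ.- x) (s≗t n) (subst (+ p ∣ℤ_) (sym (ℤₚ.+-inverseʳ (s n))) ∣0)

  ≡ₚ-isEquivalence : IsEquivalence _≡ₚ_
  ≡ₚ-isEquivalence = record
    { refl  = λ {s} → ≗⇒≡ₚ {s} λ n → refl
    ; sym   = λ {s} {t} s≡t n → subst (+ p ∣ℤ_) (neg-sub (s n) (t n)) (∣m⇒∣-m (s≡t n))
    ; trans = λ {s} {t} {u} s≡t t≡u n → subst (+ p ∣ℤ_) (sub-+-sub (s n) (t n) (u n)) (∣m∣n⇒∣m+n (s≡t n) (t≡u n))
    }
    where
    neg-sub : ∀ x y → ℤ.- (x ℤ.- y) ≡ y ℤ.- x
    neg-sub = solve-∀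
    sub-+-sub : ∀ x y z → x ℤ.- y ℤ.+ (y ℤ.- z) ≡ x ℤ.- z
    sub-+-sub = solve-∀

  ≡ₚ-setoid : Setoid 0ℓ 0ℓ
  ≡ₚ-setoid = record { isEquivalence = ≡ₚ-isEquivalence }

  shift-multiple : ∀ k {s} → Multiple s → Multiple (shift k s)
  shift-multiple k {s} ∣s n with k ≤? n
  ... | yes _ = ∣s (n ∸ k)
  ... | no  _ = ∣0

  sumToℤ-multiple : ∀ n {f} → (∀ i → i ≤ n → + p ∣ℤ f i) → + p ∣ℤ sumToℤ n f
  sumToℤ-multiple zero    ∣f = ∣f 0 z≤n
  sumToℤ-multiple (suc n) ∣f =
    ∣m∣n⇒∣m+n (sumToℤ-multiple n λ i i≤n → ∣f i (ℕₚ.m≤n⇒m≤1+n i≤n)) (∣f (suc n) ℕₚ.≤-refl)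

  respects-≡ₚ : ∀ {F} → IsLinearShiftInvariant F → (∀ {s} → Multiple s → Multiple (F s)) → F Preserves _≡ₚ_ ⟶ _≡ₚ_
  respects-≡ₚ {F} LF multiple {s} {t} s≡t n = subst (+ p ∣ℤ_) (-ₛ-homo LF s t n) (multiple s≡t n)

  divOneMinus-respects-≡ₚ : ∀ k' → divOneMinus (suc k') Preserves _≡ₚ_ ⟶ _≡ₚ_
  divOneMinus-respects-≡ₚ k' = respects-≡ₚ (divOneMinus-linearShiftInvariant k') λ ∣s n →
    sumToℤ-multiple n λ i _ → shift-multiple (i * suc k') ∣s n

  ^-respects-≡ₚ : ∀ {F} → F Preserves _≡ₚ_ ⟶ _≡ₚ_ → ∀ m → (F ^ m) Preserves _≡ₚ_ ⟶ _≡ₚ_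
  ^-respects-≡ₚ respF zero    = id
  ^-respects-≡ₚ respF (suc m) = respF ∘ ^-respects-≡ₚ respF m

  sumToℤ-interior-multiple : ∀ n f → (∀ i → 0 < i → i ≤ n → + p ∣ℤ f i) →
                             + p ∣ℤ sumToℤ (suc n) f ℤ.- (f 0 ℤ.+ f (suc n))
  sumToℤ-interior-multiple n f ∣f =
    subst (+ p ∣ℤ_) (sym (drop-last (sumToℤ n f) (f 0) (f (suc n)))) (without-first n ∣f)
    where
    drop-last : ∀ x y z → x ℤ.+ z ℤ.- (y ℤ.+ z) ≡ x ℤ.- y
    drop-last = solve-∀
    without-first : ∀ n → (∀ i → 0 < i → i ≤ n → + p ∣ℤ f i) → + p ∣ℤ sumToℤ n f ℤ.- f 0
    without-first zero     _   = subst (+ p ∣ℤ_) (sym (ℤₚ.+-inverseʳ (f 0))) ∣0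
    without-first (suc n′) ∣f′ = subst (+ p ∣ℤ_) (sym (begin
      sumToℤ (suc n′) f ℤ.- f 0                     ≡⟨ cong (ℤ._- f 0) (sumToℤ-unfoldˡ n′ f) ⟩
      f 0 ℤ.+ sumToℤ n′ (f ∘ suc) ℤ.- f 0           ≡⟨ cancel (f 0) _ ⟩
      sumToℤ n′ (f ∘ suc)                           ∎))
      (sumToℤ-multiple n′ λ i i≤n′ → ∣f′ (suc i) (s≤s z≤n) (s≤s i≤n′))
      where
      open ≡-Reasoning
      cancel : ∀ x y → x ℤ.+ y ℤ.- x ≡ y
      cancel = solve-∀

-- Frobenius: (1 - q^k)^p ≡ 1 - q^(p k) modulo an odd prime p

binomial-absorption : ∀ n k → suc k * (suc n C suc k) ≡ suc n * (n C k)
binomial-absorption zero zero = refl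
binomial-absorption zero (suc k) = begin
  suc (suc k) * (1 C suc (suc k)) ≡⟨ cong (suc (suc k) *_) (k>n⇒nCk≡0 {1} {suc (suc k)} (s≤s (s≤s z≤n))) ⟩
  suc (suc k) * 0                 ≡⟨ ℕₚ.*-zeroʳ (suc (suc k)) ⟩
  0                               ≡⟨ ℕₚ.*-zeroʳ 1 ⟨
  1 * 0                           ≡⟨ cong (1 *_) (k>n⇒nCk≡0 {0} {suc k} (s≤s z≤n)) ⟨
  1 * (0 C suc k)                 ∎
  where open ≡-Reasoning
binomial-absorption (suc n) zero = begin
  1 * (suc (suc n) C 1) ≡⟨ ℕₚ.*-identityˡ _ ⟩
  suc (suc n) C 1       ≡⟨ nC1≡n (suc (suc n)) ⟩
  suc (suc n)           ≡⟨ ℕₚ.*-identityʳ (suc (suc n)) ⟨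
  suc (suc n) * 1       ∎
  where open ≡-Reasoning
binomial-absorption (suc n) (suc k) = begin
  (2 + k) * (suc (suc n) C suc (suc k)) ≡⟨ cong ((2 + k) *_) (nCk+nC[k+1]≡[n+1]C[k+1] (suc n) (suc k)) ⟨
  (2 + k) * (x + y)                 ≡⟨ split k x y ⟩
  (1 + k) * x + x + (2 + k) * y     ≡⟨ cong₂ (λ l r → l + x + r) (binomial-absorption n k) (binomial-absorption n (suc k)) ⟩
  (1 + n) * u + x + (1 + n) * v     ≡⟨ regroup n x u v ⟩
  (1 + n) * (u + v) + x             ≡⟨ cong (λ w → (1 + n) * w + x) (nCk+nC[k+1]≡[n+1]C[k+1] n k) ⟩
  (1 + n) * x + x                   ≡⟨ ℕₚ.+-comm ((1 + n) * x) x ⟩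
  (2 + n) * x                       ∎
  where
  open ≡-Reasoning
  x = suc n C suc k
  y = suc n C suc (suc k)
  u = n C k
  v = n C suc k
  split : ∀ k x y → (2 + k) * (x + y) ≡ (1 + k) * x + x + (2 + k) * y
  split = ℕ-Solver.solve-∀
  regroup : ∀ n x u v → (1 + n) * u + x + (1 + n) * v ≡ (1 + n) * (u + v) + x
  regroup = ℕ-Solver.solve-∀

module Frobenius (p₁ : ℕ) (p-prime : Prime (suc p₁)) (2<p : 2 < suc p₁) where

  p : ℕ
  p = suc p₁

  open Congruence p

  p∣pCi : ∀ {i} → 0 < i → i < p → p ∣ p C i
  p∣pCi {suc i} _ i<p with euclidsLemma (suc i) (p C suc i) p-prime (divides (p₁ C i) (begin
      suc i * (p C suc i) ≡⟨ binomial-absorption p₁ i ⟩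
      p * (p₁ C i)        ≡⟨ ℕₚ.*-comm p (p₁ C i) ⟩
      (p₁ C i) * p        ∎))
    where open ≡-Reasoning
  ... | inj₁ p∣i   = ⊥-elim (ℕₚ.<⇒≱ i<p (∣⇒≤ p∣i))
  ... | inj₂ p∣pCi = p∣pCi

  p%2≡1 : p % 2 ≡ 1
  p%2≡1 with p % 2 in p%2≡r
  ... | 0 with prime⇒irreducible p-prime (m%n≡0⇒n∣m p 2 p%2≡r)
  ...   | inj₁ ()
  ...   | inj₂ refl = ⊥-elim (ℕₚ.<-irrefl refl 2<p)
  p%2≡1 | 1 = refl
  p%2≡1 | suc (suc r) = ⊥-elim (ℕₚ.<⇒≱ (m%n<n p 2) (subst (2 ≤_) (sym p%2≡r) (s≤s (s≤s z≤n))))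

  -1^p≡-1 : -1ℤ ℤ.^ p ≡ -1ℤ
  -1^p≡-1 = begin
    -1ℤ ℤ.^ p                       ≡⟨ cong (-1ℤ ℤ.^_) (trans (m≡m%n+[m/n]*n p 2) (cong₂ _+_ p%2≡1 (ℕₚ.*-comm (p / 2) 2))) ⟩
    -1ℤ ℤ.* (-1ℤ ℤ.^ (2 * (p / 2))) ≡⟨ cong (-1ℤ ℤ.*_) (ℤₚ.^-*-assoc -1ℤ 2 (p / 2)) ⟨
    -1ℤ ℤ.* (1ℤ ℤ.^ (p / 2))        ≡⟨ cong (-1ℤ ℤ.*_) (ℤₚ.^-zeroˡ (p / 2)) ⟩
    -1ℤ                             ∎
    where open ≡-Reasoning

  mulOneMinus^p : ∀ k s → (mulOneMinus k ^ p) s ≡ₚ mulOneMinus (p * k) s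
  mulOneMinus^p k s n = subst (+ p ∣ℤ_) (begin
    sumToℤ p g ℤ.- (g 0 ℤ.+ g p)                  ≡⟨ cong (λ x → sumToℤ p g ℤ.- x) (cong₂ ℤ._+_ g0 gp) ⟩
    sumToℤ p g ℤ.- (s n ℤ.- shift (p * k) s n)    ≡⟨ cong (ℤ._- mulOneMinus (p * k) s n) (mulOneMinus^-expansion k p s n) ⟨
    (mulOneMinus k ^ p) s n ℤ.- mulOneMinus (p * k) s n ∎)
    (sumToℤ-interior-multiple p₁ g λ i 0<i i≤p₁ → ∣m⇒∣m*n (shift (i * k) s n)
      (∣n⇒∣m*n (-1ℤ ℤ.^ i) (∣ᵤ⇒∣ (p∣pCi 0<i (s≤s i≤p₁)))))
    where
    open ≡-Reasoning
    g : ℕ → ℤ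
    g i = signedBinomial p i ℤ.* shift (i * k) s n
    g0 : g 0 ≡ s n
    g0 = trans (ℤₚ.*-identityˡ (shift 0 s n)) (shift-0 s n)
    gp : g p ≡ ℤ.- shift (p * k) s n
    gp = begin
      (-1ℤ ℤ.^ p) ℤ.* + (p C p) ℤ.* shift (p * k) s n ≡⟨ cong₂ (λ σ c → σ ℤ.* + c ℤ.* shift (p * k) s n) -1^p≡-1 (nCn≡1 p) ⟩
      -1ℤ ℤ.* 1ℤ ℤ.* shift (p * k) s n                ≡⟨ ℤₚ.-1*i≡-i (shift (p * k) s n) ⟩
      ℤ.- shift (p * k) s n                           ∎

  divOneMinus^p : ∀ k' s → (divOneMinus (suc k') ^ p) s ≡ₚ divOneMinus (p * suc k') s
  divOneMinus^p k' s = begin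
    (D ^ p) s                           ≈⟨ ≗⇒≡ₚ (preserves-≗ (^-linearShiftInvariant LD p) (sym ∘ mulOneMinus-divOneMinus K′ s)) ⟩
    (D ^ p) (mulOneMinus (p * k) X)     ≈⟨ ^-respects-≡ₚ {D} (divOneMinus-respects-≡ₚ k') p {(mulOneMinus k ^ p) X} (mulOneMinus^p k X) ⟨
    (D ^ p) ((mulOneMinus k ^ p) X)     ≈⟨ ≗⇒≡ₚ (divOneMinus^-mulOneMinus^ k' p X) ⟩
    X                                   ∎
    where
    open SetoidReasoning ≡ₚ-setoid
    k = suc k'
    K′ = k' + p₁ * k    -- p * k reduces to suc K′
    D = divOneMinus k
    LD = divOneMinus-linearShiftInvariant k'
    X = divOneMinus (p * k) s

  divOneMinus^[p∸2] : ∀ k' s → (divOneMinus (suc k') ^ (p ∸ 2)) s ≡ₚ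
                               divOneMinus (p * suc k') (mulOneMinus (suc k') (mulOneMinus (suc k') s))
  divOneMinus^[p∸2] k' s = begin
    (D ^ (p ∸ 2)) s              ≈⟨ ≗⇒≡ₚ (preserves-≗ (^-linearShiftInvariant LD (p ∸ 2)) D²X≗s) ⟨
    (D ^ (p ∸ 2)) ((D ^ 2) X)    ≈⟨ ≗⇒≡ₚ (λ n → cong (λ F → F X n) (^-homo D (p ∸ 2) 2)) ⟨
    (D ^ (p ∸ 2 + 2)) X          ≈⟨ ≗⇒≡ₚ (λ n → cong (λ e → (D ^ e) X n) (ℕₚ.m∸n+n≡m 2≤p)) ⟩
    (D ^ p) X                    ≈⟨ divOneMinus^p k' X ⟩
    divOneMinus (p * k) X        ∎
    where
    open SetoidReasoning ≡ₚ-setoid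
    k = suc k'
    D = divOneMinus k
    LD = divOneMinus-linearShiftInvariant k'
    X = mulOneMinus k (mulOneMinus k s)
    2≤p : 2 ≤ p
    2≤p = ℕₚ.<⇒≤ 2<p
    D²X≗s : (D ^ 2) X ≗ s
    D²X≗s n = trans (preserves-≗ LD (divOneMinus-mulOneMinus k' (mulOneMinus k s)) n) (divOneMinus-mulOneMinus k' s n)

-- Gauss's identity: the coefficients of Π (1 + q^j)² (1 - q^j) vanish off the triangular numbers

triangle : ℕ → ℕ
triangle zero    = 0
triangle (suc k) = suc k + triangle k

triangle-+ : ∀ a b → triangle (a + b) ≡ triangle a + a * b + triangle b
triangle-+ zero    b = refl
triangle-+ (suc a) b = trans (cong (_+_ (suc (a + b))) (triangle-+ a b)) (expand a b (triangle a) (triangle b))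
  where
  expand : ∀ a b ta tb → suc (a + b) + (ta + a * b + tb) ≡ suc a + ta + suc a * b + tb
  expand = ℕ-Solver.solve-∀

triangle-double : ∀ i → triangle i + triangle i ≡ i * suc i
triangle-double zero    = refl
triangle-double (suc i) = begin
  suc i + t + (suc i + t) ≡⟨ regroup i t ⟩
  2 * suc i + (t + t)     ≡⟨ cong (_+_ (2 * suc i)) (triangle-double i) ⟩
  2 * suc i + i * suc i   ≡⟨ factor i ⟩
  suc i * suc (suc i)     ∎
  where
  open ≡-Reasoning
  t = triangle i
  regroup : ∀ i t → suc i + t + (suc i + t) ≡ 2 * suc i + (t + t)
  regroup = ℕ-Solver.solve-∀
  factor : ∀ i → 2 * suc i + i * suc i ≡ suc i * suc (suc i)
  factor = ℕ-Solver.solve-∀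

≤-triangle : ∀ i → i ≤ triangle i
≤-triangle zero    = z≤n
≤-triangle (suc i) = ℕₚ.m≤m+n (suc i) (triangle i)

-- With T = triangle, the k-th term of the expansion of (q^N + q)⋯(q^N + q^(2N)) is a multiple of
-- q^(N² + T(N) + T(i)), where i = k - N if k ≥ N and i = N - k - 1 if k < N.
rotheExponent-above : ∀ i d → let N = i + d in N * (N + N ∸ (N + i)) + triangle (N + i) ≡ N * N + triangle N + triangle i
rotheExponent-above i d = begin
  N * (N + N ∸ (N + i)) + triangle (N + i)   ≡⟨ cong (λ x → N * x + triangle (N + i)) (trans (ℕₚ.[m+n]∸[m+o]≡n∸o N N i) (ℕₚ.m+n∸m≡n i d)) ⟩
  N * d + triangle (N + i)                   ≡⟨ cong (_+_ (N * d)) (triangle-+ N i) ⟩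
  N * d + (triangle N + N * i + triangle i)  ≡⟨ regroup i d (triangle N) (triangle i) ⟩
  N * N + triangle N + triangle i            ∎
  where
  open ≡-Reasoning
  N = i + d
  regroup : ∀ i d tN ti → (i + d) * d + (tN + (i + d) * i + ti) ≡ (i + d) * (i + d) + tN + ti
  regroup = ℕ-Solver.solve-∀

rotheExponent-below : ∀ k i → let N = suc k + i in N * (N + N ∸ k) + triangle k ≡ N * N + triangle N + triangle i
rotheExponent-below k i = begin
  N * (N + N ∸ k) + triangle k                       ≡⟨ cong (λ x → N * x + triangle k) (trans (cong (_∸ k) (regroup₁ k i)) (ℕₚ.m+n∸m≡n k (suc i + N))) ⟩
  N * (suc i + N) + triangle k                       ≡⟨ regroup₂ k i (triangle k) ⟩
  N * N + (suc (k + i) + triangle k + k * i) + i * suc i  ≡⟨ cong (_+_ (N * N + (suc (k + i) + triangle k + k * i))) (triangle-double i) ⟨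
  N * N + (suc (k + i) + triangle k + k * i) + (triangle i + triangle i)
                                                     ≡⟨ regroup₃ (N * N) (suc (k + i)) (triangle k) (k * i) (triangle i) ⟩
  N * N + (suc (k + i) + (triangle k + k * i + triangle i)) + triangle i
                                                     ≡⟨ cong (λ x → N * N + (suc (k + i) + x) + triangle i) (triangle-+ k i) ⟨
  N * N + triangle N + triangle i                    ∎
  where
  open ≡-Reasoning
  N = suc k + i
  regroup₁ : ∀ k i → suc k + i + (suc k + i) ≡ k + (suc i + (suc k + i))
  regroup₁ = ℕ-Solver.solve-∀
  regroup₂ : ∀ k i tk → (suc k + i) * (suc i + (suc k + i)) + tk ≡ (suc k + i) * (suc k + i) + (suc (k + i) + tk + k * i) + i * suc i
  regroup₂ = ℕ-Solver.solve-∀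
  regroup₃ : ∀ nn s tk ki ti → nn + (s + tk + ki) + (ti + ti) ≡ nn + (s + (tk + ki + ti)) + ti
  regroup₃ = ℕ-Solver.solve-∀

rotheExponent : ∀ N k → k ≤ N + N →
                ∃[ i ] N * (N + N ∸ k) + triangle k ≡ N * N + triangle N + triangle i × (k ≡ N + i ⊎ k + suc i ≡ N)
rotheExponent N k k≤2N with N ≤? k
... | yes N≤k with ℕₚ.m≤n⇒∃[o]m+o≡n N≤k
...   | i , refl with ℕₚ.m≤n⇒∃[o]m+o≡n (ℕₚ.+-cancelˡ-≤ N i N k≤2N)
...     | d , refl = i , rotheExponent-above i d , inj₁ refl
rotheExponent N k k≤2N | no N≰k with ℕₚ.m≤n⇒∃[o]m+o≡n (ℕₚ.≰⇒> N≰k)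
... | i , refl = i , rotheExponent-below k i , inj₂ (ℕₚ.+-suc k i)

-- qBinomial a k is the Gaussian binomial coefficient [a + k choose k] in q.
qBinomial : ℕ → ℕ → ℤSeries
qBinomial zero    k       = 1ₛ
qBinomial (suc a) zero    = 1ₛ
qBinomial (suc a) (suc k) = qBinomial a (suc k) +ₛ shift (suc a) (qBinomial (suc a) k)

qBinomial-0 : ∀ a → qBinomial a 0 ≡ 1ₛ
qBinomial-0 zero    = refl
qBinomial-0 (suc a) = refl

partsAtMost : ℕ → ℤSeries
partsAtMost a = ∏ divOneMinus a 1ₛ

partsAtMost-0 : ∀ a → partsAtMost a 0 ≡ 1ℤ
partsAtMost-0 zero    = refl
partsAtMost-0 (suc a) = trans (divOneMinus-identityBelow a (partsAtMost a) 0 (s≤s z≤n)) (partsAtMost-0 a)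

qBinomial≡partsAtMost : ∀ a k → qBinomial a k ≡[≤ k ] partsAtMost a
qBinomial≡partsAtMost zero    k       j _   = refl
qBinomial≡partsAtMost (suc a) zero    j z≤n = sym (partsAtMost-0 (suc a))
qBinomial≡partsAtMost (suc a) (suc k) j j≤ = begin
  qBinomial a (suc k) j ℤ.+ shift (suc a) (qBinomial (suc a) k) j
    ≡⟨ cong₂ ℤ._+_ (qBinomial≡partsAtMost a (suc k) j j≤) (shift-local (suc a) j λ _ →
         qBinomial≡partsAtMost (suc a) k (j ∸ suc a) (ℕₚ.≤-trans (ℕₚ.∸-monoˡ-≤ (suc a) j≤) (ℕₚ.m∸n≤m k a))) ⟩
  partsAtMost a j ℤ.+ shift (suc a) (partsAtMost (suc a)) j
    ≡⟨ divOneMinus-rec a (partsAtMost a) j ⟨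
  partsAtMost (suc a) j
    ∎
  where open ≡-Reasoning

∏mulOnePlus-linearShiftInvariant : ∀ a → IsLinearShiftInvariant (∏ mulOnePlus a)
∏mulOnePlus-linearShiftInvariant = ∏-linearShiftInvariant mulOnePlus (mulOnePlus-linearShiftInvariant ∘ suc)

∏mulOneMinus-linearShiftInvariant : ∀ a → IsLinearShiftInvariant (∏ mulOneMinus a)
∏mulOneMinus-linearShiftInvariant = ∏-linearShiftInvariant mulOneMinus (mulOneMinus-linearShiftInvariant ∘ suc)

∏mulOneMinus-partsAtMost : ∀ a → ∏ mulOneMinus a (partsAtMost a) ≗ 1ₛ
∏mulOneMinus-partsAtMost zero    = λ n → refl
∏mulOneMinus-partsAtMost (suc a) n = begin
  mulOneMinus (suc a) (∏ mulOneMinus a (divOneMinus (suc a) (partsAtMost a))) n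
    ≡⟨ preserves-≗ (mulOneMinus-linearShiftInvariant (suc a))
         (divOneMinus-comm (∏mulOneMinus-linearShiftInvariant a) a (partsAtMost a)) n ⟩
  mulOneMinus (suc a) (divOneMinus (suc a) (∏ mulOneMinus a (partsAtMost a))) n
    ≡⟨ mulOneMinus-divOneMinus a _ n ⟩
  ∏ mulOneMinus a (partsAtMost a) n
    ≡⟨ ∏mulOneMinus-partsAtMost a n ⟩
  1ₛ n
    ∎
  where open ≡-Reasoning

ascendingOnePlus : ℕ → ℕ → Op
ascendingOnePlus u zero    = id
ascendingOnePlus u (suc c) = mulOnePlus u ∘ ascendingOnePlus (suc u) c

ascendingOnePlus-linearShiftInvariant : ∀ u c → IsLinearShiftInvariant (ascendingOnePlus u c)
ascendingOnePlus-linearShiftInvariant u zero    = id-linearShiftInvariant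
ascendingOnePlus-linearShiftInvariant u (suc c) =
  ∘-linearShiftInvariant (mulOnePlus-linearShiftInvariant u) (ascendingOnePlus-linearShiftInvariant (suc u) c)

ascendingOnePlus-unfoldʳ : ∀ u c s → ascendingOnePlus u (suc c) s ≗ ascendingOnePlus u c (mulOnePlus (u + c) s)
ascendingOnePlus-unfoldʳ u zero    s n = cong (λ k → mulOnePlus k s n) (sym (ℕₚ.+-identityʳ u))
ascendingOnePlus-unfoldʳ u (suc c) s n = preserves-≗ (mulOnePlus-linearShiftInvariant u)
  (λ n′ → trans (ascendingOnePlus-unfoldʳ (suc u) c s n′)
                (cong (λ k → ascendingOnePlus (suc u) c (mulOnePlus k s) n′) (sym (ℕₚ.+-suc u c)))) n

ascendingOnePlus-1 : ∀ c s → ascendingOnePlus 1 c s ≗ ∏ mulOnePlus c s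
ascendingOnePlus-1 zero    s n = refl
ascendingOnePlus-1 (suc c) s n = begin
  ascendingOnePlus 1 (suc c) s n                 ≡⟨ ascendingOnePlus-unfoldʳ 1 c s n ⟩
  ascendingOnePlus 1 c (mulOnePlus (suc c) s) n  ≡⟨ ascendingOnePlus-1 c _ n ⟩
  ∏ mulOnePlus c (mulOnePlus (suc c) s) n        ≡⟨ mulOnePlus-comm (∏mulOnePlus-linearShiftInvariant c) (suc c) s n ⟩
  mulOnePlus (suc c) (∏ mulOnePlus c s) n        ∎
  where open ≡-Reasoning

-- Rothe's q-binomial theorem in the homogeneous form
--   (q^N + q)(q^N + q²)⋯(q^N + q^M) = Σ_{k ≤ M} q^{N (M-k) + k(k+1)/2} [M choose k].
module Rothe (N : ℕ) where

  rotheProduct : ℕ → ℤSeries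
  rotheProduct zero    = 1ₛ
  rotheProduct (suc M) = shift N (rotheProduct M) +ₛ shift (suc M) (rotheProduct M)

  rotheTerm : ℕ → ℕ → ℤSeries
  rotheTerm a k = shift (N * a + triangle k) (qBinomial a k)

  rotheTerm-suc-0 : ∀ a → rotheTerm (suc a) 0 ≗ shift N (rotheTerm a 0)
  rotheTerm-suc-0 a n = begin
    shift (N * suc a + 0) 1ₛ n            ≡⟨ cong (λ e → shift e 1ₛ n) (cong (_+ 0) (ℕₚ.*-suc N a)) ⟩
    shift (N + N * a + 0) 1ₛ n            ≡⟨ shift²-index N (N * a + 0) 1ₛ (sym (ℕₚ.+-assoc N (N * a) 0)) n ⟨
    shift N (shift (N * a + 0) 1ₛ) n      ≡⟨ shift-cong N (λ n′ → cong (λ b → shift (N * a + 0) b n′) (qBinomial-0 a)) n ⟨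
    shift N (rotheTerm a 0) n             ∎
    where open ≡-Reasoning

  rotheTerm-0-suc : ∀ k → rotheTerm 0 (suc k) ≗ shift (suc k) (rotheTerm 0 k)
  rotheTerm-0-suc k = sym ∘ shift²-index (suc k) (N * 0 + triangle k) 1ₛ (regroup N (suc k) (triangle k))
    where
    regroup : ∀ N k t → k + (N * 0 + t) ≡ N * 0 + (k + t)
    regroup = ℕ-Solver.solve-∀

  rotheTerm-pascal : ∀ a k → rotheTerm (suc a) (suc k) ≗
                     shift N (rotheTerm a (suc k)) +ₛ shift (suc (a + suc k)) (rotheTerm (suc a) k)
  rotheTerm-pascal a k n = begin
    shift E (qBinomial a (suc k) +ₛ shift (suc a) (qBinomial (suc a) k)) n
      ≡⟨ shift-+ E _ _ n ⟩
    shift E (qBinomial a (suc k)) n ℤ.+ shift E (shift (suc a) (qBinomial (suc a) k)) n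
      ≡⟨ cong₂ ℤ._+_ (sym (shift²-index N (N * a + triangle (suc k)) _ (first-index N a (triangle (suc k))) n))
                     (trans (shift-shift E (suc a) _ n) (sym (shift²-index (suc (a + suc k)) (N * suc a + triangle k) _ (second-index N a k (triangle k)) n))) ⟩
    shift N (rotheTerm a (suc k)) n ℤ.+ shift (suc (a + suc k)) (rotheTerm (suc a) k) n
      ∎
    where
    open ≡-Reasoning
    E = N * suc a + triangle (suc k)
    first-index : ∀ N a t → N + (N * a + t) ≡ N * suc a + t
    first-index = ℕ-Solver.solve-∀
    second-index : ∀ N a k t → suc (a + suc k) + (N * suc a + t) ≡ N * suc a + (suc k + t) + suc a
    second-index = ℕ-Solver.solve-∀

  expansionTerm : ℕ → ℕ → ℤSeries
  expansionTerm M k with k ≤? M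
  ... | yes _ = rotheTerm (M ∸ k) k
  ... | no  _ = 0ₛ

  expansionTerm-≤ : ∀ {M k} → k ≤ M → expansionTerm M k ≡ rotheTerm (M ∸ k) k
  expansionTerm-≤ {M} {k} k≤M with k ≤? M
  ... | yes _   = refl
  ... | no  k≰M = ⊥-elim (k≰M k≤M)

  expansionTerm-> : ∀ {M k} → M < k → expansionTerm M k ≡ 0ₛ
  expansionTerm-> {M} {k} M<k with k ≤? M
  ... | yes k≤M = ⊥-elim (ℕₚ.<⇒≱ M<k k≤M)
  ... | no  _   = refl

  expansionTerm-+ : ∀ a k → expansionTerm (a + k) k ≡ rotheTerm a k
  expansionTerm-+ a k = trans (expansionTerm-≤ (ℕₚ.m≤n+m k a)) (cong (λ b → rotheTerm b k) (ℕₚ.m+n∸n≡m a k))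

  expansionTerm-pascal : ∀ M k → expansionTerm (suc M) (suc k) ≗
                         shift N (expansionTerm M (suc k)) +ₛ shift (suc M) (expansionTerm M k)
  expansionTerm-pascal M k with ℕₚ.<-cmp k M
  ... | tri< k<M _ _ with M ∸ suc k | ℕₚ.m∸n+n≡m k<M
  ...   | a | refl = λ n → begin
    expansionTerm (suc a + suc k) (suc k) n
      ≡⟨ cong (λ s → s n) (expansionTerm-+ (suc a) (suc k)) ⟩
    rotheTerm (suc a) (suc k) n
      ≡⟨ rotheTerm-pascal a k n ⟩
    shift N (rotheTerm a (suc k)) n ℤ.+ shift (suc (a + suc k)) (rotheTerm (suc a) k) n
      ≡⟨ cong₂ (λ s t → shift N s n ℤ.+ shift (suc (a + suc k)) t n) (expansionTerm-+ a (suc k))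
               (trans (cong (λ M → expansionTerm M k) (ℕₚ.+-suc a k)) (expansionTerm-+ (suc a) k)) ⟨
    shift N (expansionTerm (a + suc k) (suc k)) n ℤ.+ shift (suc (a + suc k)) (expansionTerm (a + suc k) k) n
      ∎
    where open ≡-Reasoning
  expansionTerm-pascal M k | tri≈ _ refl _ = λ n → begin
    expansionTerm (suc M) (suc M) n
      ≡⟨ cong (λ s → s n) (expansionTerm-+ 0 (suc M)) ⟩
    rotheTerm 0 (suc M) n
      ≡⟨ rotheTerm-0-suc M n ⟩
    shift (suc M) (rotheTerm 0 M) n
      ≡⟨ ℤₚ.+-identityˡ _ ⟨
    0ℤ ℤ.+ shift (suc M) (rotheTerm 0 M) n
      ≡⟨ cong₂ ℤ._+_ (shift-0ₛ N n) (shift-cong (suc M) (λ n′ → cong (λ s → s n′) (expansionTerm-+ 0 M)) n) ⟨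
    shift N 0ₛ n ℤ.+ shift (suc M) (expansionTerm M M) n
      ≡⟨ cong (λ s → shift N s n ℤ.+ shift (suc M) (expansionTerm M M) n) (expansionTerm-> (ℕₚ.n<1+n M)) ⟨
    shift N (expansionTerm M (suc M)) n ℤ.+ shift (suc M) (expansionTerm M M) n
      ∎
    where open ≡-Reasoning
  expansionTerm-pascal M k | tri> _ _ M<k = λ n → begin
    expansionTerm (suc M) (suc k) n
      ≡⟨ cong (λ s → s n) (expansionTerm-> (s≤s M<k)) ⟩
    0ℤ
      ≡⟨ cong₂ ℤ._+_ (shift-0ₛ N n) (shift-0ₛ (suc M) n) ⟨
    shift N 0ₛ n ℤ.+ shift (suc M) 0ₛ n
      ≡⟨ cong₂ (λ s t → shift N s n ℤ.+ shift (suc M) t n)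
               (expansionTerm-> (ℕₚ.m<n⇒m<1+n M<k)) (expansionTerm-> M<k) ⟨
    shift N (expansionTerm M (suc k)) n ℤ.+ shift (suc M) (expansionTerm M k) n
      ∎
    where open ≡-Reasoning

  rothe : ∀ M → rotheProduct M ≗ sumSeries M (expansionTerm M)
  rothe zero n = sym (begin
    expansionTerm 0 0 n         ≡⟨ cong (λ s → s n) (expansionTerm-≤ {0} {0} z≤n) ⟩
    shift (N * 0 + 0) 1ₛ n      ≡⟨ cong (λ e → shift e 1ₛ n) (trans (ℕₚ.+-identityʳ (N * 0)) (ℕₚ.*-zeroʳ N)) ⟩
    shift 0 1ₛ n                ≡⟨ shift-0 1ₛ n ⟩
    1ₛ n                        ∎)
    where open ≡-Reasoning
  rothe (suc M) n = begin
    shift N X n ℤ.+ shift (suc M) X n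
      ≡⟨ cong₂ ℤ._+_ (trans (shift-cong N (rothe M) n) (shift-sumSeries N M _ n))
                     (trans (shift-cong (suc M) (rothe M) n) (shift-sumSeries (suc M) M _ n)) ⟩
    sumToℤ M (λ k → shift N (expansionTerm M k) n) ℤ.+ sumToℤ M (λ k → shift (suc M) (expansionTerm M k) n)
      ≡⟨ sumToℤ-pascal M first (λ k → expansionTerm-pascal M k n) last ⟨
    sumToℤ (suc M) (λ k → expansionTerm (suc M) k n)
      ∎
    where
    open ≡-Reasoning
    X = rotheProduct M
    first : expansionTerm (suc M) 0 n ≡ shift N (expansionTerm M 0) n
    first = begin
      expansionTerm (suc M) 0 n       ≡⟨ cong (λ s → s n) (expansionTerm-≤ {suc M} {0} z≤n) ⟩
      rotheTerm (suc M) 0 n           ≡⟨ rotheTerm-suc-0 M n ⟩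
      shift N (rotheTerm M 0) n       ≡⟨ shift-cong N (λ n′ → cong (λ s → s n′) (expansionTerm-≤ {M} {0} z≤n)) n ⟨
      shift N (expansionTerm M 0) n   ∎
    last : shift N (expansionTerm M (suc M)) n ≡ 0ℤ
    last = trans (shift-cong N (λ n′ → cong (λ s → s n′) (expansionTerm-> (ℕₚ.n<1+n M))) n) (shift-0ₛ N n)

  rotheProduct-below : ∀ M → M ≤ N → rotheProduct M ≗ shift (triangle M) (ascendingOnePlus (N ∸ M) M 1ₛ)
  rotheProduct-below zero    _   n = sym (shift-0 1ₛ n)
  rotheProduct-below (suc M) M<N n = begin
    shift N X n ℤ.+ shift (suc M) X n
      ≡⟨ cong (ℤ._+ shift (suc M) X n) (shift²-index (suc M) d X (ℕₚ.m+[n∸m]≡n M<N) n) ⟨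
    shift (suc M) (shift d X) n ℤ.+ shift (suc M) X n
      ≡⟨ ℤₚ.+-comm _ (shift (suc M) X n) ⟩
    shift (suc M) X n ℤ.+ shift (suc M) (shift d X) n
      ≡⟨ shift-+ (suc M) X (shift d X) n ⟨
    shift (suc M) (mulOnePlus d X) n
      ≡⟨ shift-cong (suc M) (preserves-≗ (mulOnePlus-linearShiftInvariant d) (rotheProduct-below M (ℕₚ.<⇒≤ M<N))) n ⟩
    shift (suc M) (mulOnePlus d (shift (triangle M) Y)) n
      ≡⟨ shift-cong (suc M) (shift-homo (mulOnePlus-linearShiftInvariant d) (triangle M) Y) n ⟩
    shift (suc M) (shift (triangle M) (mulOnePlus d Y)) n
      ≡⟨ shift-shift (suc M) (triangle M) (mulOnePlus d Y) n ⟩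
    shift (triangle (suc M)) (mulOnePlus d (ascendingOnePlus (N ∸ M) M 1ₛ)) n
      ≡⟨ cong (λ u → shift (triangle (suc M)) (mulOnePlus d (ascendingOnePlus u M 1ₛ)) n) (ℕₚ.+-∸-assoc 1 M<N) ⟩
    shift (triangle (suc M)) (ascendingOnePlus d (suc M) 1ₛ) n
      ∎
    where
    open ≡-Reasoning
    X = rotheProduct M
    Y = ascendingOnePlus (N ∸ M) M 1ₛ
    d = N ∸ suc M

  rotheProduct-above : ∀ t → rotheProduct (N + t) ≗ shift (N * t + triangle N) (∏ mulOnePlus t (ascendingOnePlus 0 N 1ₛ))
  rotheProduct-above zero n = begin
    rotheProduct (N + 0) n                               ≡⟨ cong (λ M → rotheProduct M n) (ℕₚ.+-identityʳ N) ⟩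
    rotheProduct N n                                     ≡⟨ rotheProduct-below N ℕₚ.≤-refl n ⟩
    shift (triangle N) (ascendingOnePlus (N ∸ N) N 1ₛ) n ≡⟨ cong₂ (λ e u → shift e (ascendingOnePlus u N 1ₛ) n)
                                                              (cong (_+ triangle N) (sym (ℕₚ.*-zeroʳ N))) (ℕₚ.n∸n≡0 N) ⟩
    shift (N * 0 + triangle N) (ascendingOnePlus 0 N 1ₛ) n ∎
    where open ≡-Reasoning
  rotheProduct-above (suc t) n = begin
    rotheProduct (N + suc t) n
      ≡⟨ cong (λ M → rotheProduct M n) (ℕₚ.+-suc N t) ⟩
    shift N X n ℤ.+ shift (suc (N + t)) X n
      ≡⟨ cong (ℤ._+_ (shift N X n)) (shift²-index N (suc t) X (ℕₚ.+-suc N t) n) ⟨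
    shift N X n ℤ.+ shift N (shift (suc t) X) n
      ≡⟨ shift-+ N X (shift (suc t) X) n ⟨
    shift N (mulOnePlus (suc t) X) n
      ≡⟨ shift-cong N (preserves-≗ (mulOnePlus-linearShiftInvariant (suc t)) (rotheProduct-above t)) n ⟩
    shift N (mulOnePlus (suc t) (shift E W)) n
      ≡⟨ shift-cong N (shift-homo (mulOnePlus-linearShiftInvariant (suc t)) E W) n ⟩
    shift N (shift E (mulOnePlus (suc t) W)) n
      ≡⟨ shift²-index N E _ (trans (sym (ℕₚ.+-assoc N (N * t) (triangle N))) (cong (_+ triangle N) (sym (ℕₚ.*-suc N t)))) n ⟩
    shift (N * suc t + triangle N) (∏ mulOnePlus (suc t) (ascendingOnePlus 0 N 1ₛ)) n
      ∎
    where
    open ≡-Reasoning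
    X = rotheProduct (N + t)
    E = N * t + triangle N
    W = ∏ mulOnePlus t (ascendingOnePlus 0 N 1ₛ)

partsAtMost-stable : ∀ {m a} → m ≤ a → partsAtMost a ≡[≤ m ] partsAtMost m
partsAtMost-stable m≤a = ∏-stable divOneMinus divOneMinus-identityBelow m≤a 1ₛ

1ₛ-≢0 : ∀ {x} → x ≢ 0 → 1ₛ x ≡ 0ℤ
1ₛ-≢0 {zero}  x≢0 = ⊥-elim (x≢0 refl)
1ₛ-≢0 {suc x} _   = refl

x+x≡0⇒x≡0 : ∀ {x} → x ℤ.+ x ≡ 0ℤ → x ≡ 0ℤ
x+x≡0⇒x≡0 {x} x+x≡0 = ℤₚ.*-cancelˡ-≡ (+ 2) x 0ℤ (trans (double x) x+x≡0)
  where
  double : ∀ x → + 2 ℤ.* x ≡ x ℤ.+ x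
  double = solve-∀

gaussProduct : ℕ → ℕ → ℕ → ℤSeries
gaussProduct a b c = ∏ mulOneMinus a (∏ mulOnePlus b (∏ mulOnePlus c 1ₛ))

gaussProduct-stable : ∀ {m a b c} → m ≤ a → m ≤ b → m ≤ c → gaussProduct a b c ≡[≤ m ] gaussProduct m m m
gaussProduct-stable {m} {a} {b} {c} m≤a m≤b m≤c =
  ≡[≤]-trans (∏-causal mulOneMinus (mulOneMinus-causal ∘ suc) a m
               (≡[≤]-trans (∏-causal mulOnePlus (mulOnePlus-causal ∘ suc) b m
                             (∏-stable mulOnePlus (mulOnePlus-identityBelow ∘ suc) m≤c 1ₛ))
                           (∏-stable mulOnePlus (mulOnePlus-identityBelow ∘ suc) m≤b _)))
             (∏-stable mulOneMinus (mulOneMinus-identityBelow ∘ suc) m≤a _)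

-- With N = 2m + 1, compare the coefficient of q^(m + N² + T(N)) on both sides of Rothe's identity for M = 2N,
-- multiplied by Π_{j ≤ N} (1 - q^j): on the left it is twice that of q^m in Π (1 - q^j)(1 + q^j)², on the right
-- each term contributes the coefficient of q^(m - T(i)) in Π_{j ≤ N} (1 - q^j) · [2N choose k] = 1 + O(q^(m+1)).
module Gauss (m : ℕ) where

  N : ℕ
  N = suc (m + m)

  open Rothe N

  e : ℕ
  e = N * N + triangle N

  Q : Op
  Q = ∏ mulOneMinus N

  LQ : IsLinearShiftInvariant Q
  LQ = ∏mulOneMinus-linearShiftInvariant N

  Y : ℤSeries
  Y = ∏ mulOnePlus N (∏ mulOnePlus (m + m) 1ₛ)

  W : ℤSeries
  W = ∏ mulOnePlus N (ascendingOnePlus 0 N 1ₛ)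

  W≗2Y : W ≗ mulOnePlus 0 Y
  W≗2Y n = begin
    ∏ mulOnePlus N (mulOnePlus 0 (ascendingOnePlus 1 (m + m) 1ₛ)) n
      ≡⟨ preserves-≗ (∏mulOnePlus-linearShiftInvariant N)
           (preserves-≗ (mulOnePlus-linearShiftInvariant 0) (ascendingOnePlus-1 (m + m) 1ₛ)) n ⟩
    ∏ mulOnePlus N (mulOnePlus 0 (∏ mulOnePlus (m + m) 1ₛ)) n
      ≡⟨ mulOnePlus-comm (∏mulOnePlus-linearShiftInvariant N) 0 _ n ⟩
    mulOnePlus 0 Y n
      ∎
    where open ≡-Reasoning

  term-bounds : ∀ {k i} → i ≤ m → (k ≡ N + i ⊎ k + suc i ≡ N) → m ≤ k × m ≤ N + N ∸ k
  term-bounds {k} {i} i≤m (inj₁ refl) = ℕₚ.≤-trans m≤N (ℕₚ.m≤m+n N i) , (begin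
    m                 ≤⟨ ℕₚ.n≤1+n m ⟩
    suc m             ≡⟨ cong suc (ℕₚ.m+n∸n≡m m m) ⟨
    suc (m + m ∸ m)   ≡⟨ ℕₚ.+-∸-assoc 1 (ℕₚ.m≤n+m m m) ⟨
    N ∸ m             ≤⟨ ℕₚ.∸-monoʳ-≤ N i≤m ⟩
    N ∸ i             ≡⟨ ℕₚ.[m+n]∸[m+o]≡n∸o N N i ⟨
    N + N ∸ (N + i)   ∎)
    where
    open ℕₚ.≤-Reasoning
    m≤N : m ≤ N
    m≤N = ℕₚ.≤-trans (ℕₚ.m≤m+n m m) (ℕₚ.n≤1+n (m + m))
  term-bounds {k} {i} i≤m (inj₂ k+1+i≡N) =
    ℕₚ.+-cancelʳ-≤ i m k (begin
      m + i   ≤⟨ ℕₚ.+-monoʳ-≤ m i≤m ⟩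
      m + m   ≡⟨ ℕₚ.suc-injective (trans (sym k+1+i≡N) (ℕₚ.+-suc k i)) ⟩
      k + i   ∎) ,
    (begin
      m             ≤⟨ ℕₚ.m≤m+n m m ⟩
      m + m         ≤⟨ ℕₚ.n≤1+n (m + m) ⟩
      N             ≡⟨ ℕₚ.m+n∸n≡m N N ⟨
      N + N ∸ N     ≤⟨ ℕₚ.∸-monoʳ-≤ (N + N) (subst (k ≤_) k+1+i≡N (ℕₚ.m≤m+n k (suc i))) ⟩
      N + N ∸ k     ∎)
    where open ℕₚ.≤-Reasoning

  expansionTerm-coefficient : (∀ i → triangle i ≢ m) → ∀ k → k ≤ N + N → Q (expansionTerm (N + N) k) (m + e) ≡ 0ℤ
  expansionTerm-coefficient notTriangular k k≤2N with rotheExponent N k k≤2N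
  ... | i , exponent , side = begin
    Q (expansionTerm (N + N) k) (m + e)       ≡⟨ cong (λ s → Q s (m + e)) (expansionTerm-≤ k≤2N) ⟩
    Q (shift (N * d + triangle k) B) (m + e)  ≡⟨ shift-homo LQ (N * d + triangle k) B (m + e) ⟩
    shift (N * d + triangle k) (Q B) (m + e)  ≡⟨ cong (λ x → shift x (Q B) (m + e)) exponent ⟩
    shift (e + triangle i) (Q B) (m + e)      ≡⟨ shift-+-index e (triangle i) (Q B) m ⟩
    shift (triangle i) (Q B) m                ≡⟨ vanishes (triangle i ≤? m) ⟩
    0ℤ                                        ∎
    where
    open ≡-Reasoning
    d = N + N ∸ k
    B = qBinomial d k
    vanishes : Dec (triangle i ≤ m) → shift (triangle i) (Q B) m ≡ 0ℤ
    vanishes (no  Tᵢ≰m) = shift-≰ (triangle i) (Q B) Tᵢ≰m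
    vanishes (yes Tᵢ≤m) with term-bounds (ℕₚ.≤-trans (≤-triangle i) Tᵢ≤m) side
    ... | m≤k , m≤d = begin
      shift (triangle i) (Q B) m            ≡⟨ shift-≤ (triangle i) (Q B) Tᵢ≤m ⟩
      Q B (m ∸ triangle i)                  ≡⟨ ∏-causal mulOneMinus (mulOneMinus-causal ∘ suc) N m B≡P (m ∸ triangle i) (ℕₚ.m∸n≤m m (triangle i)) ⟩
      Q (partsAtMost N) (m ∸ triangle i)    ≡⟨ ∏mulOneMinus-partsAtMost N (m ∸ triangle i) ⟩
      1ₛ (m ∸ triangle i)                   ≡⟨ 1ₛ-≢0 (λ m∸Tᵢ≡0 → notTriangular i (ℕₚ.≤-antisym Tᵢ≤m (ℕₚ.m∸n≡0⇒m≤n m∸Tᵢ≡0))) ⟩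
      0ℤ                                    ∎
      where
      B≡P : B ≡[≤ m ] partsAtMost N
      B≡P j j≤m = trans (qBinomial≡partsAtMost d k j (ℕₚ.≤-trans j≤m m≤k)) (trans (partsAtMost-stable m≤d j j≤m)
                    (sym (partsAtMost-stable (ℕₚ.≤-trans (ℕₚ.m≤m+n m m) (ℕₚ.n≤1+n (m + m))) j j≤m)))

  gauss : (∀ i → triangle i ≢ m) → gaussProduct N N (m + m) m ≡ 0ℤ
  gauss notTriangular = x+x≡0⇒x≡0 (begin
    Q Y m ℤ.+ Q Y m                                   ≡⟨ cong (ℤ._+_ (Q Y m)) (shift-0 (Q Y) m) ⟨
    mulOnePlus 0 (Q Y) m                              ≡⟨ mulOnePlus-comm LQ 0 Y m ⟨
    Q (mulOnePlus 0 Y) m                              ≡⟨ preserves-≗ LQ W≗2Y m ⟨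
    Q W m                                             ≡⟨ cong (Q W) (ℕₚ.m+n∸n≡m m e) ⟨
    Q W (m + e ∸ e)                                   ≡⟨ shift-≤ e (Q W) (ℕₚ.m≤n+m e m) ⟨
    shift e (Q W) (m + e)                             ≡⟨ shift-homo LQ e W (m + e) ⟨
    Q (shift e W) (m + e)                             ≡⟨ preserves-≗ LQ (rotheProduct-above N) (m + e) ⟨
    Q (rotheProduct (N + N)) (m + e)                  ≡⟨ preserves-≗ LQ (rothe (N + N)) (m + e) ⟩
    Q (sumSeries (N + N) (expansionTerm (N + N))) (m + e)
                                                      ≡⟨ sumSeries-homo LQ (N + N) _ (m + e) ⟩
    sumToℤ (N + N) (λ k → Q (expansionTerm (N + N) k) (m + e))
                                                      ≡⟨ sumToℤ-zero (N + N) (expansionTerm-coefficient notTriangular) ⟩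
    0ℤ                                                ∎)
    where open ≡-Reasoning

cubicFactor : ℕ → Op
cubicFactor j = mulOnePlus j ∘ mulOneMinus j ∘ mulOnePlus j

cubicFactor-comm : ∀ {F} → IsLinearShiftInvariant F → ∀ j s → F (cubicFactor j s) ≗ cubicFactor j (F s)
cubicFactor-comm {F} LF j s n = begin
  F (P (M (P s))) n    ≡⟨ mulOnePlus-comm LF j _ n ⟩
  P (F (M (P s))) n    ≡⟨ preserves-≗ (mulOnePlus-linearShiftInvariant j) (mulOneMinus-comm LF j _) n ⟩
  P (M (F (P s))) n    ≡⟨ preserves-≗ (mulOnePlus-linearShiftInvariant j)
                            (preserves-≗ (mulOneMinus-linearShiftInvariant j) (mulOnePlus-comm LF j s)) n ⟩
  P (M (P (F s))) n    ∎
  where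
  open ≡-Reasoning
  P = mulOnePlus j
  M = mulOneMinus j

∏cubicFactor≗gaussProduct : ∀ L → ∏ cubicFactor L 1ₛ ≗ gaussProduct L L L
∏cubicFactor≗gaussProduct zero    n = refl
∏cubicFactor≗gaussProduct (suc L) n = begin
  cubicFactor j (∏ cubicFactor L 1ₛ) n
    ≡⟨ preserves-≗ (cubicFactor-lsi j) (∏cubicFactor≗gaussProduct L) n ⟩
  cubicFactor j (Q (P (P 1ₛ))) n
    ≡⟨ mulOneMinus-comm (mulOnePlus-linearShiftInvariant j) j (mulOnePlus j (Q (P (P 1ₛ)))) n ⟩
  mulOneMinus j (mulOnePlus j (mulOnePlus j (Q (P (P 1ₛ))))) n
    ≡⟨ preserves-≗ (mulOneMinus-linearShiftInvariant j) (λ n′ → trans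
         (mulOnePlus-comm LQ j (mulOnePlus j (P (P 1ₛ))) n′)
         (preserves-≗ (mulOnePlus-linearShiftInvariant j) (mulOnePlus-comm LQ j (P (P 1ₛ))) n′)) n ⟨
  mulOneMinus j (Q (mulOnePlus j (mulOnePlus j (P (P 1ₛ))))) n
    ≡⟨ preserves-≗ (mulOneMinus-linearShiftInvariant j) (preserves-≗ LQ (preserves-≗ (mulOnePlus-linearShiftInvariant j)
         (mulOnePlus-comm LP j (P 1ₛ)))) n ⟨
  mulOneMinus j (Q (mulOnePlus j (P (mulOnePlus j (P 1ₛ))))) n
    ∎
  where
  open ≡-Reasoning
  j = suc L
  Q = ∏ mulOneMinus L
  P = ∏ mulOnePlus L
  LQ = ∏mulOneMinus-linearShiftInvariant L
  LP = ∏mulOnePlus-linearShiftInvariant L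
  cubicFactor-lsi : ∀ j → IsLinearShiftInvariant (cubicFactor j)
  cubicFactor-lsi j = ∘-linearShiftInvariant (mulOnePlus-linearShiftInvariant j)
    (∘-linearShiftInvariant (mulOneMinus-linearShiftInvariant j) (mulOnePlus-linearShiftInvariant j))

∏cubicFactor-nonTriangular : ∀ {L j} → j ≤ L → (∀ i → triangle i ≢ j) → ∏ cubicFactor L 1ₛ j ≡ 0ℤ
∏cubicFactor-nonTriangular {L} {j} j≤L notTriangular = begin
  ∏ cubicFactor L 1ₛ j              ≡⟨ ∏cubicFactor≗gaussProduct L j ⟩
  gaussProduct L L L j              ≡⟨ gaussProduct-stable j≤L j≤L j≤L j ℕₚ.≤-refl ⟩
  gaussProduct j j j j              ≡⟨ gaussProduct-stable j≤N j≤N (ℕₚ.m≤m+n j j) j ℕₚ.≤-refl ⟨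
  gaussProduct N N (j + j) j        ≡⟨ Gauss.gauss j notTriangular ⟩
  0ℤ                                ∎
  where
  open ≡-Reasoning
  N = suc (j + j)
  j≤N : j ≤ N
  j≤N = ℕₚ.≤-trans (ℕₚ.m≤m+n j j) (ℕₚ.n≤1+n (j + j))

-- The cubic partition generating function

≰⇒≤ᵇ≡false : ∀ {m n} → ¬ m ≤ n → (m ≤ᵇ n) ≡ false
≰⇒≤ᵇ≡false {m} {n} m≰n with m ≤ᵇ n in m≤ᵇn
... | false = refl
... | true  = ⊥-elim (m≰n (ℕₚ.≤ᵇ⇒≤ m n (subst T (sym m≤ᵇn) tt)))

toℤSeries : Series → ℤSeries
toℤSeries s n = + s n

toℤSeries-one : toℤSeries one ≗ 1ₛ
toℤSeries-one zero    = refl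
toℤSeries-one (suc n) = refl

toℤSeries-geomMul : ∀ k s → toℤSeries (geomMul k s) ≗ divOneMinus k (toℤSeries s)
toℤSeries-geomMul k s n = trans (sumToℤ-ℕ n _) (sumToℤ-cong n λ i _ → term (i * k))
  where
  term : ∀ j → + (if j ≤ᵇ n then s (n ∸ j) else 0) ≡ shift j (toℤSeries s) n
  term j with j ≤? n
  ... | yes j≤n = cong (λ b → + (if b then s (n ∸ j) else 0)) (Equivalence.to T-≡ (ℕₚ.≤⇒≤ᵇ j≤n))
  ... | no  j≰n = cong (λ b → + (if b then s (n ∸ j) else 0)) (≰⇒≤ᵇ≡false j≰n)


toℤSeries-geomPow : ∀ k' m s → toℤSeries (geomPow (suc k') m s) ≗ (divOneMinus (suc k') ^ m) (toℤSeries s)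
toℤSeries-geomPow k' zero    s = λ n → refl
toℤSeries-geomPow k' (suc m) s n = trans (toℤSeries-geomMul (suc k') (geomPow (suc k') m s) n)
  (preserves-≗ (divOneMinus-linearShiftInvariant k') (toℤSeries-geomPow k' m s) n)

toℤSeries-cubicProd : ∀ c M → toℤSeries (cubicProd c (suc M)) ≗
                      divOneMinus (suc M) ((divOneMinus (2 * suc M) ^ (c ∸ 1)) (toℤSeries (cubicProd c M)))
toℤSeries-cubicProd c M n = trans (toℤSeries-geomMul (suc M) _ n)
  (preserves-≗ (divOneMinus-linearShiftInvariant M) (toℤSeries-geomPow _ (c ∸ 1) (cubicProd c M)) n)

mulOneMinus-double : ∀ j s → mulOneMinus (2 * j) s ≗ mulOneMinus j (mulOnePlus j s)
mulOneMinus-double j s n = begin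
  s n ℤ.- shift (2 * j) s n                                  ≡⟨ cancel (s n) (shift j s n) _ ⟨
  s n ℤ.+ shift j s n ℤ.- (shift j s n ℤ.+ shift (2 * j) s n)
    ≡⟨ cong (λ x → s n ℤ.+ shift j s n ℤ.- (shift j s n ℤ.+ x))
            (shift²-index j j s (cong (_+_ j) (sym (ℕₚ.+-identityʳ j))) n) ⟨
  s n ℤ.+ shift j s n ℤ.- (shift j s n ℤ.+ shift j (shift j s) n)
    ≡⟨ cong (ℤ._-_ (s n ℤ.+ shift j s n)) (shift-+ j s (shift j s) n) ⟨
  mulOneMinus j (mulOnePlus j s) n                           ∎
  where
  open ≡-Reasoning
  cancel : ∀ x y z → x ℤ.+ y ℤ.- (y ℤ.+ z) ≡ x ℤ.- z
  cancel = solve-∀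

divOneMinus-mulOneMinus-double² : ∀ j' s → divOneMinus (suc j') (mulOneMinus (2 * suc j') (mulOneMinus (2 * suc j') s)) ≗
                                           cubicFactor (suc j') s
divOneMinus-mulOneMinus-double² j' s n = begin
  D (M₂ (M₂ s)) n        ≡⟨ preserves-≗ (divOneMinus-linearShiftInvariant j') (mulOneMinus-double j (M₂ s)) n ⟩
  D (M (P (M₂ s))) n     ≡⟨ divOneMinus-mulOneMinus j' (P (M₂ s)) n ⟩
  P (M₂ s) n             ≡⟨ preserves-≗ (mulOnePlus-linearShiftInvariant j) (mulOneMinus-double j s) n ⟩
  P (M (P s)) n          ∎
  where
  open ≡-Reasoning
  j = suc j'
  D = divOneMinus j
  M = mulOneMinus j
  P = mulOnePlus j
  M₂ = mulOneMinus (2 * j)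

module CubicPartitions (p₁ : ℕ) (p-prime : Prime (suc p₁)) (2<p : 2 < suc p₁) where

  open Frobenius p₁ p-prime 2<p
  open Congruence p

  frobeniusFactor : ℕ → Op
  frobeniusFactor j = divOneMinus (p * (2 * j))

  ∏frobeniusFactor-linearShiftInvariant : ∀ M → IsLinearShiftInvariant (∏ frobeniusFactor M)
  ∏frobeniusFactor-linearShiftInvariant =
    ∏-linearShiftInvariant frobeniusFactor λ j → divOneMinus-linearShiftInvariant _

  cubicProd≡ₚ : ∀ M → toℤSeries (cubicProd (p ∸ 1) M) ≡ₚ ∏ frobeniusFactor M (∏ cubicFactor M 1ₛ)
  cubicProd≡ₚ zero = ≗⇒≡ₚ toℤSeries-one
  cubicProd≡ₚ (suc M) = begin
    toℤSeries (cubicProd (p ∸ 1) (suc M))           ≈⟨ ≗⇒≡ₚ (toℤSeries-cubicProd (p ∸ 1) M) ⟩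
    D ((D₂ ^ (p ∸ 2)) (toℤSeries (cubicProd (p ∸ 1) M)))
                                                    ≈⟨ divOneMinus-respects-≡ₚ M (^-respects-≡ₚ {D₂} (divOneMinus-respects-≡ₚ _) (p ∸ 2)
                                                         {toℤSeries (cubicProd (p ∸ 1) M)} (cubicProd≡ₚ M)) ⟩
    D ((D₂ ^ (p ∸ 2)) Z)                            ≈⟨ divOneMinus-respects-≡ₚ M {(D₂ ^ (p ∸ 2)) Z} (divOneMinus^[p∸2] _ Z) ⟩
    D (frobeniusFactor j (M₂ (M₂ Z)))               ≈⟨ ≗⇒≡ₚ (divOneMinus-comm (divOneMinus-linearShiftInvariant M) _ (M₂ (M₂ Z))) ⟩
    frobeniusFactor j (D (M₂ (M₂ Z)))               ≈⟨ ≗⇒≡ₚ (preserves-≗ (divOneMinus-linearShiftInvariant _) (divOneMinus-mulOneMinus-double² M Z)) ⟩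
    frobeniusFactor j (cubicFactor j Z)             ≈⟨ ≗⇒≡ₚ (preserves-≗ (divOneMinus-linearShiftInvariant _)
                                                         (cubicFactor-comm (∏frobeniusFactor-linearShiftInvariant M) j _)) ⟨
    ∏ frobeniusFactor (suc M) (∏ cubicFactor (suc M) 1ₛ) ∎
    where
    open SetoidReasoning ≡ₚ-setoid
    j = suc M
    D = divOneMinus j
    D₂ = divOneMinus (2 * j)
    M₂ = mulOneMinus (2 * j)
    Z = ∏ frobeniusFactor M (∏ cubicFactor M 1ₛ)

  MultipleOnResidue : ℕ → ℕ → ℤSeries → Set
  MultipleOnResidue r L s = ∀ j → j ≤ L → j % p ≡ r → + p ∣ℤ s j

  frobeniusFactor-multipleOnResidue : ∀ k r L {s} → MultipleOnResidue r L s → MultipleOnResidue r L (divOneMinus (p * k) s)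
  frobeniusFactor-multipleOnResidue k r L {s} ∣s j j≤L j%p≡r = sumToℤ-multiple j λ i _ → term i
    where
    term : ∀ i → + p ∣ℤ shift (i * (p * k)) s j
    term i with i * (p * k) ≤? j
    ... | no  _   = ∣0
    ... | yes ≤j = ∣s (j ∸ i * (p * k)) (ℕₚ.≤-trans (ℕₚ.m∸n≤m j (i * (p * k))) j≤L) (begin
      (j ∸ i * (p * k)) % p                     ≡⟨ [m+kn]%n≡m%n (j ∸ i * (p * k)) (i * k) p ⟨
      (j ∸ i * (p * k) + i * k * p) % p         ≡⟨ cong (λ x → (j ∸ i * (p * k) + x) % p) (regroup i k p) ⟩
      (j ∸ i * (p * k) + i * (p * k)) % p       ≡⟨ cong (_% p) (ℕₚ.m∸n+n≡m ≤j) ⟩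
      j % p                                     ≡⟨ j%p≡r ⟩
      r                                         ∎)
      where
      open ≡-Reasoning
      regroup : ∀ i k p → i * k * p ≡ i * (p * k)
      regroup = ℕ-Solver.solve-∀

  ∏frobeniusFactor-multipleOnResidue : ∀ M r L {s} → MultipleOnResidue r L s → MultipleOnResidue r L (∏ frobeniusFactor M s)
  ∏frobeniusFactor-multipleOnResidue zero    r L ∣s = ∣s
  ∏frobeniusFactor-multipleOnResidue (suc M) r L ∣s =
    frobeniusFactor-multipleOnResidue (2 * suc M) r L (∏frobeniusFactor-multipleOnResidue M r L ∣s)

  nonresidue⇒nonTriangular : ∀ r → QuadNonresidue p (8 * r + 1) → ∀ j → j % p ≡ r → ∀ i → triangle i ≢ j
  nonresidue⇒nonTriangular r nonresidue j j%p≡r i refl = nonresidue (suc (2 * i) , (begin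
    (suc (2 * i) * suc (2 * i)) % p               ≡⟨ cong (_% p) (odd-square i) ⟩
    (8 * triangle i + 1) % p                      ≡⟨ cong (λ x → (8 * x + 1) % p) (m≡m%n+[m/n]*n (triangle i) p) ⟩
    (8 * (r′ + q * p) + 1) % p                    ≡⟨ cong (_% p) (regroup r′ q p) ⟩
    (8 * r′ + 1 + 8 * q * p) % p                  ≡⟨ [m+kn]%n≡m%n (8 * r′ + 1) (8 * q) p ⟩
    (8 * r′ + 1) % p                              ≡⟨ cong (λ x → (8 * x + 1) % p) j%p≡r ⟩
    (8 * r + 1) % p                               ∎))
    where
    open ≡-Reasoning
    r′ = triangle i % p
    q = triangle i / p
    odd-square : ∀ i → suc (2 * i) * suc (2 * i) ≡ 8 * triangle i + 1
    odd-square i = begin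
      suc (2 * i) * suc (2 * i)             ≡⟨ expand i ⟩
      4 * (i * suc i) + 1                   ≡⟨ cong (λ x → 4 * x + 1) (triangle-double i) ⟨
      4 * (triangle i + triangle i) + 1     ≡⟨ collect (triangle i) ⟩
      8 * triangle i + 1                    ∎
      where
      expand : ∀ i → suc (2 * i) * suc (2 * i) ≡ 4 * (i * suc i) + 1
      expand = ℕ-Solver.solve-∀
      collect : ∀ t → 4 * (t + t) + 1 ≡ 8 * t + 1
      collect = ℕ-Solver.solve-∀
    regroup : ∀ r q p → 8 * (r + q * p) + 1 ≡ 8 * r + 1 + 8 * q * p
    regroup = ℕ-Solver.solve-∀

  cubicPartitions-multiple : ∀ r → QuadNonresidue p (8 * r + 1) → ∀ L → L % p ≡ r → p ∣ a (p ∸ 1) L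
  cubicPartitions-multiple r nonresidue L L%p≡r = ∣⇒∣ᵤ (subst (+ p ∣ℤ_) (x-y+y≡x (+ a (p ∸ 1) L) Z) (∣m∣n⇒∣m+n (cubicProd≡ₚ L L) ∣Z))
    where
    Z = ∏ frobeniusFactor L (∏ cubicFactor L 1ₛ) L
    ∣Z : + p ∣ℤ Z
    ∣Z = ∏frobeniusFactor-multipleOnResidue L r L (λ j j≤L j%p≡r →
           subst (+ p ∣ℤ_) (sym (∏cubicFactor-nonTriangular j≤L (nonresidue⇒nonTriangular r nonresidue j j%p≡r))) ∣0)
         L ℕₚ.≤-refl L%p≡r
    x-y+y≡x : ∀ x y → x ℤ.- y ℤ.+ y ≡ x
    x-y+y≡x = solve-∀

theorem1p2 : (p : ℕ) → .{{_ : NonZero p}} → Prime p → 2 < p → (r : ℕ) → 1 ≤ r → r ≤ p ∸ 1 → QuadNonresidue p (8 * r + 1) → (n : ℕ) → p ∣ a (p ∸ 1) (p * n + r)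
theorem1p2 (suc p₁) p-prime 2<p r _ r≤p₁ nonresidue n =
  CubicPartitions.cubicPartitions-multiple p₁ p-prime 2<p r nonresidue (suc p₁ * n + r) (begin
    (suc p₁ * n + r) % suc p₁   ≡⟨ cong (_% suc p₁) (trans (ℕₚ.+-comm (suc p₁ * n) r) (cong (_+_ r) (ℕₚ.*-comm (suc p₁) n))) ⟩
    (r + n * suc p₁) % suc p₁   ≡⟨ [m+kn]%n≡m%n r n (suc p₁) ⟩
    r % suc p₁                  ≡⟨ m<n⇒m%n≡m (s≤s r≤p₁) ⟩
    r                           ∎)
  where open ≡-Reasoning
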